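{- Let $\alpha,\gamma\vDash n$ with $\gamma\le_\ell\alpha$ (lexicographic order). Then \[K^*_{\alpha,\gamma}=\sum_{\beta\succcurlyeq\gamma}L_{\alpha,\beta^c}=\sum_{\beta\succcurlyeq\gamma}L^*_{\alpha,\beta},\] where both sums run over compositions $\beta$ of $n$ that are coarsenings of $\gamma$.
   Context: For a composition $\alpha\vDash n$: its diagram has $\alpha_i$ left-justified boxes in row $i$, row 1 at the bottom. A row-strict immaculate tableau of shape $\alpha$ is a filling with positive integers whose leftmost column weakly increases bottom to top and whose rows strictly increase left to right; it has content $\gamma=(\gamma_1,\dots,\gamma_m)$ if it contains exactly $\gamma_i$ entries equal to $i$ for each $i$. $K^*_{\alpha,\gamma}$ is the number of row-strict immaculate tableaux of shape $\alpha$ and content $\gamma$. A standard immaculate tableau of shape $\alpha$ is a filling with $1,\dots,n$ each used once, leftmost column increasing bottom to top and rows increasing left to right. For such $T$, $\mathrm{Des}_{\mathfrak S^*}(T)=\{i: i+1 \text{ is strictly above } i\}$ and $\mathrm{Des}_{\mathcal R\mathfrak S^*}(T)=\{i:i+1\text{ is weakly below } i\}$. For $D=\{s_1<\dots<s_j\}\subseteq\{1,\dots,n-1\}$, $\mathrm{comp}(D)=(s_1,s_2-s_1,\dots,n-s_j)$, with inverse $\mathrm{set}$. $L_{\alpha,\beta}$ (resp. $L^*_{\alpha,\beta}$) is the number of standard immaculate tableaux $T$ of shape $\alpha$ with $\mathrm{comp}(\mathrm{Des}_{\mathfrak S^*}(T))=\beta$ (resp. $\mathrm{comp}(\mathrm{Des}_{\mathcal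 R\mathfrak S^*}(T))=\beta$). $\beta^c=\mathrm{comp}(\{1,\dots,n-1\}\setminus\mathrm{set}(\beta))$. $\beta\succcurlyeq\gamma$ means each part of $\beta$ is a sum of consecutive parts of $\gamma$. -}

module Defs where

open import Data.Nat using (ℕ; zero; suc; _+_; _∸_; _≤_; _<_; _≟_; _≤?_; _<?_)
open import Data.Nat.Properties using (m+[n∸m]≡n; m+n∸m≡n; m≤m+n)
open import Data.List using (List; []; _∷_; [_]; map; concat; concatMap; filter; length; upTo; replicate)
open import Data.Nat.ListAction using (sum)
open import Data.List.Properties using (≡-dec)
open import Data.List.Relation.Unary.All using (All; all?)
open import Data.List.Relation.Unary.Linked using (Linked; linked?)
open import Data.List.Relation.Binary.Lex.Strict using (Lex-≤)
open import Data.List.Membership.DecPropositional _≟_ using (_∈?_; _∉_)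
open import Data.Bool using (Bool; true; false; if_then_else_)
open import Data.Product using (_×_; _,_)
open import Data.Sum using (_⊎_; inj₁; inj₂)
open import Relation.Nullary using (Dec; yes; no; ¬_; does)
open import Relation.Nullary.Decidable using (_×-dec_; _⊎-dec_; map′; ¬?)
open import Relation.Binary.PropositionalEquality using (_≡_; refl; sym; subst)

IsComposition : ℕ → List ℕ → Set
IsComposition n α = All (λ k → 0 < k) α × sum α ≡ n

isComposition? : ∀ n α → Dec (IsComposition n α)
isComposition? n α = all? (λ k → 0 <? k) α ×-dec (sum α ≟ n)

_≤ℓ_ : List ℕ → List ℕ → Set
_≤ℓ_ = Lex-≤ _≡_ _<_

-- Coarsening: β ≽ γ iff each part of β is a sum of consecutive parts of γ
-- (the parts of γ being used in order, each exactly once).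
--   stop  : the current part of β ends with the current part of γ
--   merge : the current part of β is the current part g of γ plus a
--           (nonempty) run of following parts of γ

data _≽_ : List ℕ → List ℕ → Set where
  done  : [] ≽ []
  stop  : ∀ {b β γ} → β ≽ γ → (b ∷ β) ≽ (b ∷ γ)
  merge : ∀ {b g β γ} → (b ∷ β) ≽ γ → ((g + b) ∷ β) ≽ (g ∷ γ)

_≽?_ : ∀ β γ → Dec (β ≽ γ)
[] ≽? [] = yes done
[] ≽? (g ∷ γ) = no λ ()
(c ∷ β) ≽? [] = no λ ()
(c ∷ β) ≽? (g ∷ γ) =
  map′ from to ((c ≟ g ×-dec β ≽? γ) ⊎-dec (g ≤? c ×-dec ((c ∸ g) ∷ β) ≽? γ))
  where
  from : (c ≡ g × β ≽ γ) ⊎ (g ≤ c × ((c ∸ g) ∷ β) ≽ γ) → (c ∷ β) ≽ (g ∷ γ)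
  from (inj₁ (refl , p)) = stop p
  from (inj₂ (le , q)) = subst (λ x → (x ∷ β) ≽ (g ∷ γ)) (m+[n∸m]≡n le) (merge q)
  to : (c ∷ β) ≽ (g ∷ γ) → (c ≡ g × β ≽ γ) ⊎ (g ≤ c × ((c ∸ g) ∷ β) ≽ γ)
  to (stop p) = inj₁ (refl , p)
  to (merge {b = b} p) =
    inj₂ (m≤m+n g b , subst (λ x → (x ∷ β) ≽ γ) (sym (m+n∸m≡n g b)) p)

listsOf : ℕ → ℕ → List (List ℕ)
listsOf zero B = [ [] ]
listsOf (suc k) B = concatMap (λ x → map (x ∷_) (listsOf k B)) (map suc (upTo B))

-- all fillings of the diagram of shape α (row i of the diagram = i-th
-- list, row 1 at the bottom = head) with entries in {1,…,B}
fillings : List ℕ → ℕ → List (List (List ℕ))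
fillings [] B = [ [] ]
fillings (k ∷ α) B = concatMap (λ r → map (r ∷_) (fillings α B)) (listsOf k B)

compositions : ℕ → List (List ℕ)
compositions n = filter (isComposition? n) (concatMap (λ k → listsOf k n) (upTo (suc n)))

coarsenings : ℕ → List ℕ → List (List ℕ)
coarsenings n γ = filter (_≽? γ) (compositions n)

occ : ℕ → List ℕ → ℕ
occ x xs = length (filter (x ≟_) xs)

firstColumn : List (List ℕ) → List ℕ
firstColumn [] = []
firstColumn ([] ∷ T) = firstColumn T
firstColumn ((x ∷ r) ∷ T) = x ∷ firstColumn T

contentUpTo : ℕ → List (List ℕ) → List ℕ
contentUpTo m T = map (λ i → occ (suc i) (concat T)) (upTo m)

RowStrictImmaculate : List (List ℕ) → Set
RowStrictImmaculate T = Linked _≤_ (firstColumn T) × All (Linked _<_) T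

rowStrictImmaculate? : ∀ T → Dec (RowStrictImmaculate T)
rowStrictImmaculate? T = linked? _≤?_ (firstColumn T) ×-dec all? (linked? _<?_) T

HasContent : List ℕ → List (List ℕ) → Set
HasContent γ T = contentUpTo (length γ) T ≡ γ

hasContent? : ∀ γ T → Dec (HasContent γ T)
hasContent? γ T = ≡-dec _≟_ (contentUpTo (length γ) T) γ

-- K*_{α,γ}: fillings of shape α with entries in {1,…,ℓ(γ)} (any filling
-- with content γ of a shape of size |γ| has entries there) that are
-- row-strict immaculate with content γ
Kstar : List ℕ → List ℕ → ℕ
Kstar α γ = length (filter (λ T → rowStrictImmaculate? T ×-dec hasContent? γ T)
                           (fillings α (length γ)))

Standard : ℕ → List (List ℕ) → Set
Standard n T = contentUpTo n T ≡ replicate n 1 × Linked _<_ (firstColumn T) × All (Linked _<_) T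

standard? : ∀ n T → Dec (Standard n T)
standard? n T = ≡-dec _≟_ (contentUpTo n T) (replicate n 1)
  ×-dec (linked? _<?_ (firstColumn T) ×-dec all? (linked? _<?_) T)

rowOf : ℕ → List (List ℕ) → ℕ
rowOf x [] = 0
rowOf x (r ∷ T) = if does (x ∈? r) then 0 else suc (rowOf x T)

range1 : ℕ → List ℕ
range1 n = map suc (upTo (n ∸ 1))

DesS : ℕ → List (List ℕ) → List ℕ
DesS n T = filter (λ i → rowOf i T <? rowOf (suc i) T) (range1 n)

DesRS : ℕ → List (List ℕ) → List ℕ
DesRS n T = filter (λ i → rowOf (suc i) T ≤? rowOf i T) (range1 n)

compAux : ℕ → ℕ → List ℕ → List ℕ
compAux n prev [] = [ n ∸ prev ]
compAux n prev (s ∷ D) = (s ∸ prev) ∷ compAux n s D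

comp : ℕ → List ℕ → List ℕ
comp n D = compAux n 0 D

setAux : ℕ → List ℕ → List ℕ
setAux acc [] = []
setAux acc (b ∷ []) = []
setAux acc (b ∷ b′ ∷ β) = (acc + b) ∷ setAux (acc + b) (b′ ∷ β)

setOf : List ℕ → List ℕ
setOf β = setAux 0 β

complement : ℕ → List ℕ → List ℕ
complement n β = comp n (filter (λ i → ¬? (i ∈? setOf β)) (range1 n))

L : List ℕ → List ℕ → ℕ
L α β = length (filter (λ T → standard? (sum α) T ×-dec ≡-dec _≟_ (comp (sum α) (DesS (sum α) T)) β)
                       (fillings α (sum α)))

Lstar : List ℕ → List ℕ → ℕ
Lstar α β = length (filter (λ T → standard? (sum α) T ×-dec ≡-dec _≟_ (comp (sum α) (DesRS (sum α) T)) β)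
                           (fillings α (sum α)))

{-# OPTIONS --safe #-}
-- Standardization replaces the entries equal to x + 1 of a row-strict immaculate tableau
-- of content γ by the cells of the (x + 1)-st block of γ, from the bottom row up.  This
-- is a bijection onto the standard immaculate tableaux T in which i + 1 lies strictly
-- above i whenever i and i + 1 share a block, i.e. DesRS(T) ⊆ set(γ), i.e.
-- comp(DesRS(T)) ≽ γ; sorting these by comp(DesRS(T)) gives the sum of the L*_{α,β}.
-- Since DesS(T) is the complement of DesRS(T), comp(DesS(T)) = β^c exactly when
-- comp(DesRS(T)) = β, which gives the sum of the L_{α,β^c}.  Compositions of n are
-- handled as bit vectors of cuts on {1,…,n-1}: coarsening becomes the pointwise order
-- and complementation becomes negation.
module Submission where

open import Defs
open import Algebra.Properties.CommutativeSemigroup using (interchange)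
open import Data.Bool as Bool using (Bool; true; false; not; _∧_; _∨_; if_then_else_)
open import Data.Bool.Properties using (∧-zeroʳ; ∧-comm; ∧-conicalˡ; ∧-conicalʳ; ∧-distribʳ-∨; ∨-assoc; not-involutive; ¬-not)
open import Data.Empty using (⊥-elim)
open import Data.List using (List; []; _∷_; [_]; map; concat; concatMap; filter; filterᵇ; length; upTo; replicate; applyUpTo; _++_)
open import Data.List.Properties
  using (≡-dec; ∷-injective; ++-assoc; ++-identityʳ; length-map; length-++; length-replicate; filter-++; map-++; map-∘;
         map-cong; map-cong-local; map-id-local; concat-map; concat-++)
open import Data.List.Relation.Binary.Pointwise using (Pointwise; []; _∷_)
open import Data.List.Relation.Unary.All as All using (All; []; _∷_)
open import Data.List.Relation.Unary.All.Properties using (concat⁺; map⁺; ++⁻ʳ; ++⁻ˡ; filter⁺; all-filter)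
open import Data.List.Relation.Unary.Linked as Linked using (Linked; []; [-]; _∷_)
open import Data.List.Relation.Unary.Linked.Properties using (Linked⇒All) renaming (map⁺ to Linked-map⁺)
open import Data.Nat using (ℕ; zero; suc; _+_; _∸_; _≤_; _<_; _≟_; _≤?_; _<?_; z≤n; s≤s)
open import Data.Nat.ListAction using (sum)
open import Data.List.Membership.DecPropositional _≟_ using (_∈?_)
open import Data.Nat.Properties
open import Data.Product using (_×_; _,_; proj₁; proj₂; Σ)
open import Data.Sum using (inj₁; inj₂)
open import Function using (_∘_; id)
open import Function.Bundles using (mk⇔; _⇔_; Equivalence)
open import Function.Properties.Equivalence using () renaming (trans to ⇔-trans)
open import Relation.Binary.Definitions using (DecidableEquality; tri<; tri≈; tri>)
open import Relation.Binary.PropositionalEquality hiding ([_])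
open import Relation.Nullary using (Dec; yes; no; does; ¬?)
open import Relation.Nullary.Decidable using (dec-true; dec-false; does-⇔; T?; _×-dec_)
open import Relation.Unary using (Decidable)

χ : Bool → ℕ
χ true  = 1
χ false = 0

count : {A : Set} → (A → Bool) → List A → ℕ
count p xs = length (filterᵇ p xs)

filter≡filterᵇ : {A : Set} {P : A → Set} (P? : Decidable P) (xs : List A) →
  filter P? xs ≡ filterᵇ (does ∘ P?) xs
filter≡filterᵇ P? [] = refl
filter≡filterᵇ P? (x ∷ xs) with does (P? x)
... | true  = cong (x ∷_) (filter≡filterᵇ P? xs)
... | false = filter≡filterᵇ P? xs

count-∷ : {A : Set} (p : A → Bool) (x : A) (xs : List A) → count p (x ∷ xs) ≡ χ (p x) + count p xs
count-∷ p x xs with p x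
... | true  = refl
... | false = refl

count≡sum-χ : {A : Set} (p : A → Bool) (xs : List A) → count p xs ≡ sum (map (χ ∘ p) xs)
count≡sum-χ p [] = refl
count≡sum-χ p (x ∷ xs) = trans (count-∷ p x xs) (cong (χ (p x) +_) (count≡sum-χ p xs))

count-cong-local : {A : Set} {p q : A → Bool} {xs : List A} →
  All (λ x → p x ≡ q x) xs → count p xs ≡ count q xs
count-cong-local {p = p} {q} {[]} [] = refl
count-cong-local {p = p} {q} {x ∷ xs} (e ∷ es) = begin
  count p (x ∷ xs)         ≡⟨ count-∷ p x xs ⟩
  χ (p x) + count p xs     ≡⟨ cong₂ _+_ (cong χ e) (count-cong-local es) ⟩
  χ (q x) + count q xs     ≡⟨ count-∷ q x xs ⟨
  count q (x ∷ xs)         ∎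
  where open ≡-Reasoning

count-cong : {A : Set} {p q : A → Bool} → (∀ x → p x ≡ q x) → (xs : List A) → count p xs ≡ count q xs
count-cong p≗q xs = count-cong-local (All.universal p≗q xs)

count-++ : {A : Set} (p : A → Bool) (xs ys : List A) → count p (xs ++ ys) ≡ count p xs + count p ys
count-++ p xs ys = trans (cong length (filter-++ (T? ∘ p) xs ys)) (length-++ (filterᵇ p xs))

count-concat : {A : Set} (p : A → Bool) (xss : List (List A)) → count p (concat xss) ≡ sum (map (count p) xss)
count-concat p [] = refl
count-concat p (xs ∷ xss) = trans (count-++ p xs (concat xss)) (cong (count p xs +_) (count-concat p xss))

count-map : {A B : Set} (p : B → Bool) (f : A → B) (xs : List A) → count p (map f xs) ≡ count (p ∘ f) xs
count-map p f [] = refl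
count-map p f (x ∷ xs) =
  trans (count-∷ p (f x) (map f xs)) (trans (cong (χ (p (f x)) +_) (count-map p f xs)) (sym (count-∷ (p ∘ f) x xs)))

count-false : {A : Set} (xs : List A) → count (λ _ → false) xs ≡ 0
count-false [] = refl
count-false (x ∷ xs) = count-false xs

count-∧ˡ : {A : Set} (b : Bool) (p : A → Bool) (xs : List A) →
  count (λ x → b ∧ p x) xs ≡ (if b then count p xs else 0)
count-∧ˡ true p xs = refl
count-∧ˡ false p xs = count-false xs

count-filterᵇ : {A : Set} (p q : A → Bool) (xs : List A) → count p (filterᵇ q xs) ≡ count (λ x → q x ∧ p x) xs
count-filterᵇ p q [] = refl
count-filterᵇ p q (x ∷ xs) with q x
... | false = count-filterᵇ p q xs
... | true with p x
...   | true = cong suc (count-filterᵇ p q xs)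
...   | false = count-filterᵇ p q xs

multiplicity : {A : Set} → DecidableEquality A → A → List A → ℕ
multiplicity _≟_ x = count (λ y → does (x ≟ y))

multiplicity-filterᵇ : {A : Set} (_≟_ : DecidableEquality A) (q : A → Bool) (x : A) (xs : List A) →
  multiplicity _≟_ x (filterᵇ q xs) ≡ (if q x then multiplicity _≟_ x xs else 0)
multiplicity-filterᵇ _≟_ q x xs =
  trans (count-filterᵇ _ q xs) (trans (count-cong only-x xs) (count-∧ˡ (q x) _ xs))
  where
  only-x : ∀ y → q y ∧ does (x ≟ y) ≡ q x ∧ does (x ≟ y)
  only-x y with x ≟ y
  ... | yes refl = refl
  ... | no _ = trans (∧-zeroʳ (q y)) (sym (∧-zeroʳ (q x)))

sum-map-+ : {A : Set} (f g : A → ℕ) (xs : List A) →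
  sum (map (λ x → f x + g x) xs) ≡ sum (map f xs) + sum (map g xs)
sum-map-+ f g [] = refl
sum-map-+ f g (x ∷ xs) =
  trans (cong (f x + g x +_) (sum-map-+ f g xs)) (interchange +-commutativeSemigroup (f x) (g x) (sum (map f xs)) (sum (map g xs)))

sum-map-cong-local : {A : Set} {f g : A → ℕ} {xs : List A} → All (λ x → f x ≡ g x) xs → sum (map f xs) ≡ sum (map g xs)
sum-map-cong-local es = cong sum (map-cong-local es)

sum-map-zero : {A : Set} (xs : List A) → sum (map (λ _ → 0) xs) ≡ 0
sum-map-zero [] = refl
sum-map-zero (x ∷ xs) = sum-map-zero xs

sum-map-swap : {A B : Set} (h : A → B → ℕ) (xs : List A) (ys : List B) →
  sum (map (λ y → sum (map (λ x → h x y) xs)) ys) ≡ sum (map (λ x → sum (map (h x) ys)) xs)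
sum-map-swap h [] ys = sum-map-zero ys
sum-map-swap h (x ∷ xs) ys =
  trans (sum-map-+ (h x) (λ y → sum (map (λ x → h x y) xs)) ys) (cong (sum (map (h x) ys) +_) (sum-map-swap h xs ys))

-- Both counts equal the number of pairs (x , y) with p x and f x ≡ y.
count-bijection :
  {A B : Set} (_≟ᴬ_ : DecidableEquality A) (_≟ᴮ_ : DecidableEquality B)
  {VA : A → Set} {VB : B → Set} (p : A → Bool) (q : B → Bool) (f : A → B) (g : B → A)
  {xs : List A} {ys : List B} → All VA xs → All VB ys →
  (∀ {x} → VA x → p x ≡ true → q (f x) ≡ true × g (f x) ≡ x × multiplicity _≟ᴮ_ (f x) ys ≡ 1) →
  (∀ {y} → VB y → q y ≡ true → p (g y) ≡ true × f (g y) ≡ y × multiplicity _≟ᴬ_ (g y) xs ≡ 1) →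
  count p xs ≡ count q ys
count-bijection {A} {B} _≟ᴬ_ _≟ᴮ_ {VA} {VB} p q f g {xs} {ys} vxs vys f-ok g-ok = begin
  count p xs                                       ≡⟨ count≡sum-χ p xs ⟩
  sum (map (χ ∘ p) xs)                             ≡⟨ sum-map-cong-local (All.map row-sum vxs) ⟨
  sum (map (λ x → sum (map (h x) ys)) xs)          ≡⟨ sum-map-swap h xs ys ⟨
  sum (map (λ y → sum (map (λ x → h x y) xs)) ys)  ≡⟨ sum-map-cong-local (All.map column-sum vys) ⟩
  sum (map (χ ∘ q) ys)                             ≡⟨ count≡sum-χ q ys ⟨
  count q ys                                       ∎
  where
  open ≡-Reasoning
  h : A → B → ℕ
  h x y = χ (p x ∧ does (f x ≟ᴮ y))

  row-sum : ∀ {x} → VA x → sum (map (h x) ys) ≡ χ (p x)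
  row-sum {x} vx = trans (sym (count≡sum-χ _ ys)) (trans (count-∧ˡ (p x) _ ys) (by-p (p x) refl))
    where
    by-p : ∀ b → p x ≡ b → (if b then multiplicity _≟ᴮ_ (f x) ys else 0) ≡ χ b
    by-p true px = proj₂ (proj₂ (f-ok vx px))
    by-p false _ = refl

  column-sum : ∀ {y} → VB y → sum (map (λ x → h x y) xs) ≡ χ (q y)
  column-sum {y} vy with q y in qy
  ... | false = trans (sym (count≡sum-χ _ xs)) (trans (count-cong-local (All.map none vxs)) (count-false xs))
    where
    none : ∀ {x} → VA x → p x ∧ does (f x ≟ᴮ y) ≡ false
    none {x} vx with p x in px | f x ≟ᴮ y
    ... | true | yes refl = trans (sym (proj₁ (f-ok vx px))) qy
    ... | true | no _ = refl
    ... | false | _ = refl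
  ... | true = trans (sym (count≡sum-χ _ xs)) (trans (count-cong-local (All.map agree vxs)) g-mult)
    where
    pg = proj₁ (g-ok vy qy)
    fg = proj₁ (proj₂ (g-ok vy qy))
    g-mult = proj₂ (proj₂ (g-ok vy qy))
    agree : ∀ {x} → VA x → p x ∧ does (f x ≟ᴮ y) ≡ does (g y ≟ᴬ x)
    agree {x} vx with p x in px | f x ≟ᴮ y | g y ≟ᴬ x
    ... | true  | yes _   | yes _ = refl
    ... | true  | yes refl | no gfx≢x = ⊥-elim (gfx≢x (proj₁ (proj₂ (f-ok vx px))))
    ... | true  | no fx≢y | yes refl = ⊥-elim (fx≢y fg)
    ... | true  | no _    | no _ = refl
    ... | false | _       | yes refl = trans (sym px) pg
    ... | false | _       | no _ = refl

interval : ℕ → ℕ → List ℕ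
interval k zero = []
interval k (suc m) = k ∷ interval (suc k) m

length-interval : ∀ k m → length (interval k m) ≡ m
length-interval k zero = refl
length-interval k (suc m) = cong suc (length-interval (suc k) m)

map-suc-interval : ∀ k m → map suc (interval k m) ≡ interval (suc k) m
map-suc-interval k zero = refl
map-suc-interval k (suc m) = cong (suc k ∷_) (map-suc-interval (suc k) m)

upTo≡interval : ∀ m → upTo m ≡ interval 0 m
upTo≡interval m = go 0 m id (λ _ → refl)
  where
  go : ∀ k m (f : ℕ → ℕ) → (∀ i → f i ≡ k + i) → applyUpTo f m ≡ interval k m
  go k zero f f≗k+ = refl
  go k (suc m) f f≗k+ =
    cong₂ _∷_ (trans (f≗k+ 0) (+-identityʳ k)) (go (suc k) m (f ∘ suc) (λ i → trans (f≗k+ (suc i)) (+-suc k i)))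

range1≡interval : ∀ n → range1 n ≡ interval 1 (n ∸ 1)
range1≡interval n = trans (cong (map suc) (upTo≡interval (n ∸ 1))) (map-suc-interval 0 (n ∸ 1))

All-interval : ∀ k m → All (λ v → k ≤ v × v < k + m) (interval k m)
All-interval k zero = []
All-interval k (suc m) =
  (≤-refl , m<m+n k (s≤s z≤n)) ∷
  All.map (λ { {v} (k<v , v<) → <⇒≤ k<v , subst (v <_) (sym (+-suc k m)) v< }) (All-interval (suc k) m)

All-interval⁺ : {P : ℕ → Set} (k m : ℕ) → (∀ i → k ≤ i → i < k + m → P i) → All P (interval k m)
All-interval⁺ k m h = All.map (λ { {i} (k≤i , i<) → h i k≤i i< }) (All-interval k m)

All-interval⁻ : {P : ℕ → Set} (k m : ℕ) → All P (interval k m) → ∀ i → k ≤ i → i < k + m → P i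
All-interval⁻ k zero [] i k≤i i< = ⊥-elim (<⇒≱ i< (subst (_≤ i) (sym (+-identityʳ k)) k≤i))
All-interval⁻ k (suc m) (pk ∷ ps) i k≤i i< with k ≟ i
... | yes refl = pk
... | no k≢i = All-interval⁻ (suc k) m ps i (≤∧≢⇒< k≤i k≢i) (subst (i <_) (+-suc k m) i<)

map-cong-interval : {A : Set} {f g : ℕ → A} (k m : ℕ) → (∀ i → k ≤ i → f i ≡ g i) →
  map f (interval k m) ≡ map g (interval k m)
map-cong-interval k m f≗g = map-cong-local (All.map (λ (k≤i , _) → f≗g _ k≤i) (All-interval k m))

_∈ᵇ_ : ℕ → List ℕ → Bool
i ∈ᵇ S = does (i ∈? S)

-- compᵇ c (b₁ ∷ …) is comp of the set {i | bᵢ = true}, where the part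
-- in progress already holds suc c cells.
compᵇ : ℕ → List Bool → List ℕ
compᵇ c [] = suc c ∷ []
compᵇ c (true ∷ bs) = suc c ∷ compᵇ 0 bs
compᵇ c (false ∷ bs) = compᵇ (suc c) bs

compAux≡compᵇ : ∀ n prev c k m (p : ℕ → Bool) → k + m ≡ n → prev + suc c ≡ k →
  compAux n prev (filterᵇ p (interval k m)) ≡ compᵇ c (map p (interval k m))
compAux≡compᵇ n prev c k zero p k+0≡n prev+c≡k =
  cong [_] (trans (cong (_∸ prev) (trans (sym k+0≡n) (trans (+-identityʳ k) (sym prev+c≡k)))) (m+n∸m≡n prev (suc c)))
compAux≡compᵇ n prev c k (suc m) p k+m≡n prev+c≡k with p k
... | true = cong₂ _∷_ (trans (cong (_∸ prev) (sym prev+c≡k)) (m+n∸m≡n prev (suc c)))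
               (compAux≡compᵇ n k 0 (suc k) m p (trans (sym (+-suc k m)) k+m≡n) (+-comm k 1))
... | false = compAux≡compᵇ n prev (suc c) (suc k) m p (trans (sym (+-suc k m)) k+m≡n)
               (trans (+-suc prev (suc c)) (cong suc prev+c≡k))

comp≡compᵇ : ∀ n → 1 ≤ n → {P : ℕ → Set} (P? : Decidable P) →
  comp n (filter P? (range1 n)) ≡ compᵇ 0 (map (does ∘ P?) (interval 1 (n ∸ 1)))
comp≡compᵇ n 1≤n P? rewrite filter≡filterᵇ P? (range1 n) | range1≡interval n =
  compAux≡compᵇ n 0 0 1 (n ∸ 1) (does ∘ P?) (m+[n∸m]≡n 1≤n) refl

compᵇ-head : ∀ c bs → Σ ℕ λ h → Σ (List ℕ) λ t → compᵇ c bs ≡ h ∷ t × suc c ≤ h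
compᵇ-head c [] = suc c , [] , refl , ≤-refl
compᵇ-head c (true ∷ bs) = suc c , compᵇ 0 bs , refl , ≤-refl
compᵇ-head c (false ∷ bs) with compᵇ-head (suc c) bs
... | h , t , e , c<h = h , t , e , <⇒≤ c<h

compᵇ-injective : ∀ c bs bs′ → length bs ≡ length bs′ → compᵇ c bs ≡ compᵇ c bs′ → bs ≡ bs′
compᵇ-injective c [] [] _ _ = refl
compᵇ-injective c (true ∷ bs) (true ∷ bs′) l e =
  cong (true ∷_) (compᵇ-injective 0 bs bs′ (suc-injective l) (proj₂ (∷-injective e)))
compᵇ-injective c (false ∷ bs) (false ∷ bs′) l e =
  cong (false ∷_) (compᵇ-injective (suc c) bs bs′ (suc-injective l) e)
compᵇ-injective c (true ∷ bs) (false ∷ bs′) _ e with compᵇ-head (suc c) bs′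
... | h , t , e′ , c<h = ⊥-elim (1+n≰n (≤-trans c<h (≤-reflexive (sym (proj₁ (∷-injective (trans e e′)))))))
compᵇ-injective c (false ∷ bs) (true ∷ bs′) _ e with compᵇ-head (suc c) bs
... | h , t , e′ , c<h = ⊥-elim (1+n≰n (≤-trans c<h (≤-reflexive (proj₁ (∷-injective (trans (sym e′) e))))))

compᵇ-isComposition : ∀ c bs → IsComposition (suc (c + length bs)) (compᵇ c bs)
compᵇ-isComposition c [] = s≤s z≤n ∷ [] , cong suc (trans (+-identityʳ c) (sym (+-identityʳ c)))
compᵇ-isComposition c (true ∷ bs) with compᵇ-isComposition 0 bs
... | pos , total = s≤s z≤n ∷ pos , cong (suc c +_) total
compᵇ-isComposition c (false ∷ bs) with compᵇ-isComposition (suc c) bs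
... | pos , total = pos , trans total (cong suc (sym (+-suc c (length bs))))

comp-isComposition : ∀ n → 1 ≤ n → {P : ℕ → Set} (P? : Decidable P) → IsComposition n (comp n (filter P? (range1 n)))
comp-isComposition n 1≤n P? rewrite comp≡compᵇ n 1≤n P? with compᵇ-isComposition 0 (map (does ∘ P?) (interval 1 (n ∸ 1)))
... | pos , total = pos , trans total (trans (cong suc (trans (length-map _ (interval 1 (n ∸ 1))) (length-interval 1 (n ∸ 1)))) (m+[n∸m]≡n 1≤n))

∉-setAux-below : ∀ acc b β i → i < acc + b → i ∈ᵇ setAux acc (b ∷ β) ≡ false
∉-setAux-below acc b [] i i< = refl
∉-setAux-below acc b (b′ ∷ β) i i<
  rewrite dec-false (i ≟ acc + b) (λ e → <-irrefl e i<)
  = ∉-setAux-below (acc + b) b′ β i (<-≤-trans i< (m≤m+n (acc + b) b′))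

-- Reading starts at cell k of the part b, which begins at cell acc + 1; d of its cells lie beyond k.
compᵇ-setAux : ∀ β′ d acc c b k → All (0 <_) β′ → acc + suc c ≡ k → b ≡ suc (c + d) →
  compᵇ c (map (_∈ᵇ setAux acc (b ∷ β′)) (interval k (d + sum β′))) ≡ b ∷ β′
compᵇ-setAux β′ (suc d) acc c b k pos acc+c≡k b≡ =
  trans (cong (λ x → compᵇ c (x ∷ map (_∈ᵇ setAux acc (b ∷ β′)) (interval (suc k) (d + sum β′))))
           (∉-setAux-below acc b β′ k k<acc+b))
    (compᵇ-setAux β′ d acc (suc c) b (suc k) pos (trans (+-suc acc (suc c)) (cong suc acc+c≡k))
      (trans b≡ (cong suc (+-suc c d))))
  where
  k<acc+b : k < acc + b
  k<acc+b = subst (_< acc + b) acc+c≡k (+-monoʳ-< acc (subst (suc c <_) (sym b≡) (s≤s (m<m+n c (s≤s z≤n)))))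
compᵇ-setAux [] zero acc c b k [] acc+c≡k b≡ = cong [_] (sym (trans b≡ (cong suc (+-identityʳ c))))
compᵇ-setAux (suc e ∷ β″) zero acc c b k (_ ∷ pos) acc+c≡k b≡ =
  trans (cong (λ x → compᵇ c ((x ∨ (k ∈ᵇ setAux (acc + b) (suc e ∷ β″))) ∷ rest)) (dec-true (k ≟ acc + b) k≡acc+b))
    (cong₂ _∷_ (sym b≡suc-c)
      (trans (cong (compᵇ 0) (map-cong-interval (suc k) (e + sum β″) beyond))
        (compᵇ-setAux β″ e (acc + b) 0 (suc e) (suc k) pos (trans (+-comm (acc + b) 1) (cong suc (sym k≡acc+b))) refl)))
  where
  b≡suc-c : b ≡ suc c
  b≡suc-c = trans b≡ (cong suc (+-identityʳ c))
  k≡acc+b : k ≡ acc + b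
  k≡acc+b = trans (sym acc+c≡k) (cong (acc +_) (sym b≡suc-c))
  beyond : ∀ i → suc k ≤ i → i ∈ᵇ setAux acc (b ∷ suc e ∷ β″) ≡ i ∈ᵇ setAux (acc + b) (suc e ∷ β″)
  beyond i k<i = cong (_∨ (i ∈ᵇ setAux (acc + b) (suc e ∷ β″))) (dec-false (i ≟ acc + b) (λ i≡ → <-irrefl (trans k≡acc+b (sym i≡)) k<i))
  rest : List Bool
  rest = map (_∈ᵇ setAux acc (b ∷ suc e ∷ β″)) (interval (suc k) (e + sum β″))

compᵇ-setOf : ∀ n β → 1 ≤ n → IsComposition n β → compᵇ 0 (map (_∈ᵇ setOf β) (interval 1 (n ∸ 1))) ≡ β
compᵇ-setOf .(suc c + sum β) (suc c ∷ β) _ (_ ∷ pos , refl) = compᵇ-setAux β c 0 0 (suc c) 1 pos refl refl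

map-not-swap : {f g : ℕ → Bool} (xs : List ℕ) → map f xs ≡ map (not ∘ g) xs → map (not ∘ f) xs ≡ map g xs
map-not-swap {f} {g} xs e = begin
  map (not ∘ f) xs          ≡⟨ map-∘ xs ⟩
  map not (map f xs)        ≡⟨ cong (map not) e ⟩
  map not (map (not ∘ g) xs) ≡⟨ map-∘ xs ⟨
  map (not ∘ not ∘ g) xs    ≡⟨ map-cong (not-involutive ∘ g) xs ⟩
  map g xs                  ∎
  where open ≡-Reasoning

compᵇ-map-not-swap : (f g : ℕ → Bool) (xs : List ℕ) →
  compᵇ 0 (map f xs) ≡ compᵇ 0 (map (not ∘ g) xs) → compᵇ 0 (map (not ∘ f) xs) ≡ compᵇ 0 (map g xs)
compᵇ-map-not-swap f g xs e =
  cong (compᵇ 0) (map-not-swap xs (compᵇ-injective 0 _ _ (trans (length-map f xs) (sym (length-map _ xs))) e))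

does-≤?≡not-<? : ∀ a b → does (b ≤? a) ≡ not (does (a <? b))
does-≤?≡not-<? a b with a <? b
... | yes a<b = trans (dec-false (b ≤? a) (<⇒≱ a<b)) (sym (cong not (dec-true (a <? b) a<b)))
... | no a≮b = trans (dec-true (b ≤? a) (≮⇒≥ a≮b)) (sym (cong not (dec-false (a <? b) a≮b)))

ascent : List (List ℕ) → ℕ → Bool
ascent T i = does (rowOf i T <? rowOf (suc i) T)

comp-DesS : ∀ n → 1 ≤ n → ∀ T → comp n (DesS n T) ≡ compᵇ 0 (map (ascent T) (interval 1 (n ∸ 1)))
comp-DesS n 1≤n T = comp≡compᵇ n 1≤n (λ i → rowOf i T <? rowOf (suc i) T)

comp-DesRS : ∀ n → 1 ≤ n → ∀ T → comp n (DesRS n T) ≡ compᵇ 0 (map (not ∘ ascent T) (interval 1 (n ∸ 1)))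
comp-DesRS n 1≤n T =
  trans (comp≡compᵇ n 1≤n (λ i → rowOf (suc i) T ≤? rowOf i T))
        (cong (compᵇ 0) (map-cong-interval 1 (n ∸ 1) (λ i _ → does-≤?≡not-<? (rowOf i T) (rowOf (suc i) T))))

length-filter-cong : {A : Set} {P Q : A → Set} (P? : Decidable P) (Q? : Decidable Q) (xs : List A) →
  (∀ x → does (P? x) ≡ does (Q? x)) → length (filter P? xs) ≡ length (filter Q? xs)
length-filter-cong P? Q? xs P≗Q =
  trans (cong length (filter≡filterᵇ P? xs)) (trans (count-cong P≗Q xs) (sym (cong length (filter≡filterᵇ Q? xs))))

DesS≡complement⇔DesRS≡ : ∀ n β T → 1 ≤ n → IsComposition n β →
  (comp n (DesS n T) ≡ complement n β) ⇔ (comp n (DesRS n T) ≡ β)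
DesS≡complement⇔DesRS≡ n β T 1≤n cβ = mk⇔ to from
  where
  cuts = interval 1 (n ∸ 1)
  cut = _∈ᵇ setOf β
  β≡ : β ≡ compᵇ 0 (map cut cuts)
  β≡ = sym (compᵇ-setOf n β 1≤n cβ)
  βᶜ≡ : complement n β ≡ compᵇ 0 (map (not ∘ cut) cuts)
  βᶜ≡ = comp≡compᵇ n 1≤n (λ i → ¬? (i ∈? setOf β))
  to : comp n (DesS n T) ≡ complement n β → comp n (DesRS n T) ≡ β
  to e = trans (comp-DesRS n 1≤n T)
    (trans (compᵇ-map-not-swap (ascent T) cut cuts (trans (sym (comp-DesS n 1≤n T)) (trans e βᶜ≡))) (sym β≡))
  from : comp n (DesRS n T) ≡ β → comp n (DesS n T) ≡ complement n β
  from e = trans (comp-DesS n 1≤n T)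
    (trans (sym (compᵇ-map-not-swap cut (ascent T) cuts (trans (sym β≡) (trans (sym e) (comp-DesRS n 1≤n T))))) (sym βᶜ≡))

L-complement≡Lstar : ∀ n α β → 1 ≤ n → IsComposition n α → IsComposition n β → L α (complement n β) ≡ Lstar α β
L-complement≡Lstar .(sum α) α β 1≤n (_ , refl) cβ =
  length-filter-cong _ _ (fillings α (sum α))
    (λ T → cong (does (standard? (sum α) T) ∧_) (does-⇔ (DesS≡complement⇔DesRS≡ (sum α) β T 1≤n cβ)
      (≡-dec _≟_ (comp (sum α) (DesS (sum α) T)) (complement (sum α) β)) (≡-dec _≟_ (comp (sum α) (DesRS (sum α) T)) β)))

compᵇ-uncons : ∀ bs → Σ ℕ λ h → Σ (List ℕ) λ t → compᵇ 0 bs ≡ h ∷ t × (∀ c → compᵇ c bs ≡ (c + h) ∷ t)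
compᵇ-uncons [] = 1 , [] , refl , λ c → cong [_] (+-comm 1 c)
compᵇ-uncons (true ∷ bs) = 1 , compᵇ 0 bs , refl , λ c → cong (_∷ compᵇ 0 bs) (+-comm 1 c)
compᵇ-uncons (false ∷ bs) with compᵇ-uncons bs
... | h , t , _ , shift = suc h , t , shift 1 , λ c → trans (shift (suc c)) (cong (_∷ t) (sym (+-suc c h)))

≽-sum : ∀ {β γ} → β ≽ γ → sum β ≡ sum γ
≽-sum done = refl
≽-sum (stop {b} p) = cong (b +_) (≽-sum p)
≽-sum (merge {b} {g} p) = trans (+-assoc g b _) (cong (g +_) (≽-sum p))

≽-head-≥ : ∀ {b β g γ} → (b ∷ β) ≽ (g ∷ γ) → g ≤ b
≽-head-≥ (stop _) = ≤-refl
≽-head-≥ (merge _) = m≤m+n _ _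

Pointwise⇒compᵇ-≽ : ∀ c {xs ys} → Pointwise Bool._≤_ xs ys → compᵇ c xs ≽ compᵇ c ys
Pointwise⇒compᵇ-≽ c [] = stop done
Pointwise⇒compᵇ-≽ c (Bool.b≤b {true} ∷ xs≤ys) = stop (Pointwise⇒compᵇ-≽ 0 xs≤ys)
Pointwise⇒compᵇ-≽ c (Bool.b≤b {false} ∷ xs≤ys) = Pointwise⇒compᵇ-≽ (suc c) xs≤ys
Pointwise⇒compᵇ-≽ c (_∷_ {xs = xs} Bool.f≤t xs≤ys) with compᵇ-uncons xs | Pointwise⇒compᵇ-≽ 0 xs≤ys
... | h , t , e₀ , shift | xs≽ys rewrite shift (suc c) = merge (subst (_≽ _) e₀ xs≽ys)

compᵇ-≽⇒Pointwise : ∀ {β γ} → β ≽ γ → ∀ c xs ys → length xs ≡ length ys →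
  β ≡ compᵇ c xs → γ ≡ compᵇ c ys → Pointwise Bool._≤_ xs ys
compᵇ-≽⇒Pointwise _ c [] [] _ _ _ = []
compᵇ-≽⇒Pointwise (stop p) c (true ∷ xs) (true ∷ ys) l eβ eγ =
  Bool.b≤b ∷ compᵇ-≽⇒Pointwise p 0 xs ys (suc-injective l) (proj₂ (∷-injective eβ)) (proj₂ (∷-injective eγ))
compᵇ-≽⇒Pointwise (merge {b = b} {g = g} p) c (true ∷ xs) (true ∷ ys) _ eβ eγ with compᵇ-head 0 ys
... | h , t , e , 1≤h =
  ⊥-elim (1+n≰n (≤-trans 1≤h (≤-trans (≽-head-≥ (subst (_ ≽_) (trans (proj₂ (∷-injective eγ)) e) p)) (≤-reflexive b≡0))))
  where
  b≡0 : b ≡ 0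
  b≡0 = +-cancelˡ-≡ g b 0 (trans (proj₁ (∷-injective eβ)) (trans (sym (proj₁ (∷-injective eγ))) (sym (+-identityʳ g))))
compᵇ-≽⇒Pointwise β≽γ c (true ∷ xs) (false ∷ ys) _ eβ eγ with compᵇ-head (suc c) ys
... | h , t , e , c<h = ⊥-elim (1+n≰n (≤-trans c<h (≽-head-≥ (subst₂ _≽_ eβ (trans eγ e) β≽γ))))
compᵇ-≽⇒Pointwise β≽γ c (false ∷ xs) (false ∷ ys) l eβ eγ =
  Bool.b≤b ∷ compᵇ-≽⇒Pointwise β≽γ (suc c) xs ys (suc-injective l) eβ eγ
compᵇ-≽⇒Pointwise (stop p) c (false ∷ xs) (true ∷ ys) _ eβ eγ with compᵇ-head (suc c) xs
... | h , t , e , c<h =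
  ⊥-elim (1+n≰n (≤-trans c<h (≤-reflexive (trans (sym (proj₁ (∷-injective (trans eβ e)))) (proj₁ (∷-injective eγ))))))
compᵇ-≽⇒Pointwise (merge {b = b} {g = g} p) c (false ∷ xs) (true ∷ ys) l eβ eγ with compᵇ-uncons xs
... | h , t , e₀ , shift =
  Bool.f≤t ∷ compᵇ-≽⇒Pointwise p 0 xs ys (suc-injective l) (trans (cong₂ _∷_ b≡h β′≡t) (sym e₀)) (proj₂ (∷-injective eγ))
  where
  heads = ∷-injective (trans eβ (shift (suc c)))
  b≡h : b ≡ h
  b≡h = +-cancelˡ-≡ g b h (trans (proj₁ heads) (cong (_+ h) (sym (proj₁ (∷-injective eγ)))))
  β′≡t = proj₂ heads

compᵇ-≽⇔Pointwise : ∀ xs ys → length xs ≡ length ys → (compᵇ 0 xs ≽ compᵇ 0 ys) ⇔ Pointwise Bool._≤_ xs ys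
compᵇ-≽⇔Pointwise xs ys l = mk⇔ (λ xs≽ys → compᵇ-≽⇒Pointwise xs≽ys 0 xs ys l refl refl) (Pointwise⇒compᵇ-≽ 0)

Pointwise-map⁺ : {R : Bool → Bool → Set} {f g : ℕ → Bool} {xs : List ℕ} →
  All (λ x → R (f x) (g x)) xs → Pointwise R (map f xs) (map g xs)
Pointwise-map⁺ [] = []
Pointwise-map⁺ (r ∷ rs) = r ∷ Pointwise-map⁺ rs

Pointwise-map⁻ : {R : Bool → Bool → Set} {f g : ℕ → Bool} (xs : List ℕ) →
  Pointwise R (map f xs) (map g xs) → All (λ x → R (f x) (g x)) xs
Pointwise-map⁻ [] [] = []
Pointwise-map⁻ (x ∷ xs) (r ∷ rs) = r ∷ Pointwise-map⁻ xs rs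

not-does-≤⇔ : {A : Set} (a? : Dec A) (c : Bool) → (not (does a?) Bool.≤ c) ⇔ (c ≡ false → A)
not-does-≤⇔ (yes a) true = mk⇔ (λ _ _ → a) (λ _ → Bool.f≤t)
not-does-≤⇔ (yes a) false = mk⇔ (λ _ _ → a) (λ _ → Bool.b≤b)
not-does-≤⇔ (no ¬a) true = mk⇔ (λ _ ()) (λ _ → Bool.b≤b)
not-does-≤⇔ (no ¬a) false = mk⇔ (λ ()) (λ h → ⊥-elim (¬a (h refl)))

-- DesRS(T) ⊆ set(γ), stated contrapositively.
DesRS⊆setOf : ℕ → List ℕ → List (List ℕ) → Set
DesRS⊆setOf n γ T = ∀ i → 1 ≤ i → i < n → i ∈ᵇ setOf γ ≡ false → rowOf i T < rowOf (suc i) T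

DesRS-≽⇔DesRS⊆setOf : ∀ n γ T → 1 ≤ n → IsComposition n γ → (comp n (DesRS n T) ≽ γ) ⇔ DesRS⊆setOf n γ T
DesRS-≽⇔DesRS⊆setOf n γ T 1≤n cγ = mk⇔ to from
  where
  cuts = interval 1 (n ∸ 1)
  cut = _∈ᵇ setOf γ
  bits⇔ = compᵇ-≽⇔Pointwise (map (not ∘ ascent T) cuts) (map cut cuts) (trans (length-map _ cuts) (sym (length-map _ cuts)))
  γ≡ = compᵇ-setOf n γ 1≤n cγ
  cells : 1 + (n ∸ 1) ≡ n
  cells = m+[n∸m]≡n 1≤n
  to : comp n (DesRS n T) ≽ γ → DesRS⊆setOf n γ T
  to DesRS≽γ i 1≤i i<n = Equivalence.to (not-does-≤⇔ (rowOf i T <? rowOf (suc i) T) (cut i))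
    (All-interval⁻ 1 (n ∸ 1) (Pointwise-map⁻ cuts (Equivalence.to bits⇔ (subst₂ _≽_ (comp-DesRS n 1≤n T) (sym γ≡) DesRS≽γ)))
      i 1≤i (subst (i <_) (sym cells) i<n))
  from : DesRS⊆setOf n γ T → comp n (DesRS n T) ≽ γ
  from ⊆ = subst₂ _≽_ (sym (comp-DesRS n 1≤n T)) γ≡ (Equivalence.from bits⇔ (Pointwise-map⁺ (All-interval⁺ 1 (n ∸ 1)
    (λ i 1≤i i< → Equivalence.from (not-does-≤⇔ (rowOf i T <? rowOf (suc i) T) (cut i)) (⊆ i 1≤i (subst (i <_) cells i<))))))

_∈[1,_] : ℕ → ℕ → Set
x ∈[1, B ] = 1 ≤ x × x ≤ B

_≟ₗ_ : DecidableEquality (List ℕ)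
_≟ₗ_ = ≡-dec _≟_

_≟ₜ_ : DecidableEquality (List (List ℕ))
_≟ₜ_ = ≡-dec _≟ₗ_

sum-interval-outside : ∀ y c k m → y < k → sum (map (λ x → if does (y ≟ x) then c else 0) (interval k m)) ≡ 0
sum-interval-outside y c k zero y<k = refl
sum-interval-outside y c k (suc m) y<k rewrite dec-false (y ≟ k) (<⇒≢ y<k) =
  sum-interval-outside y c (suc k) m (m<n⇒m<1+n y<k)

sum-interval-point : ∀ y c k m → k ≤ y → y < k + m → sum (map (λ x → if does (y ≟ x) then c else 0) (interval k m)) ≡ c
sum-interval-point y c k zero k≤y y< = ⊥-elim (<⇒≱ y< (subst (_≤ y) (sym (+-identityʳ k)) k≤y))
sum-interval-point y c k (suc m) k≤y y< with y ≟ k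
... | yes refl rewrite dec-true (y ≟ y) refl = trans (cong (c +_) (sum-interval-outside y c (suc y) m ≤-refl)) (+-identityʳ c)
... | no y≢k rewrite dec-false (y ≟ k) y≢k = sum-interval-point y c (suc k) m (≤∧≢⇒< k≤y (y≢k ∘ sym)) (subst (y <_) (+-suc k m) y<)

sum-map-cong : {A : Set} {f g : A → ℕ} → (∀ x → f x ≡ g x) → (xs : List A) → sum (map f xs) ≡ sum (map g xs)
sum-map-cong f≗g xs = cong sum (map-cong f≗g xs)

count-concatMap : {A B : Set} (p : B → Bool) (f : A → List B) (xs : List A) →
  count p (concatMap f xs) ≡ sum (map (count p ∘ f) xs)
count-concatMap p f xs = trans (count-concat p (map f xs)) (cong sum (sym (map-∘ xs)))

letters≡interval : ∀ B → map suc (upTo B) ≡ interval 1 B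
letters≡interval B = trans (cong (map suc) (upTo≡interval B)) (map-suc-interval 0 B)

multiplicity-listsOf : ∀ j B k → All (_∈[1, B ]) k → multiplicity _≟ₗ_ k (listsOf j B) ≡ χ (does (length k ≟ j))
multiplicity-listsOf zero B [] _ = refl
multiplicity-listsOf zero B (y ∷ k) _ = refl
multiplicity-listsOf (suc j) B [] _ = begin
  multiplicity _≟ₗ_ [] (listsOf (suc j) B)
    ≡⟨ count-concatMap _ (λ x → map (x ∷_) (listsOf j B)) (map suc (upTo B)) ⟩
  sum (map (λ x → multiplicity _≟ₗ_ [] (map (x ∷_) (listsOf j B))) (map suc (upTo B)))
    ≡⟨ sum-map-cong (λ x → trans (count-map _ (x ∷_) (listsOf j B)) (count-false (listsOf j B))) (map suc (upTo B)) ⟩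
  sum (map (λ _ → 0) (map suc (upTo B)))
    ≡⟨ sum-map-zero (map suc (upTo B)) ⟩
  0 ∎
  where open ≡-Reasoning
multiplicity-listsOf (suc j) B (y ∷ k) ((1≤y , y≤B) ∷ k∈) = begin
  multiplicity _≟ₗ_ (y ∷ k) (listsOf (suc j) B)
    ≡⟨ count-concatMap _ (λ x → map (x ∷_) (listsOf j B)) (map suc (upTo B)) ⟩
  sum (map (λ x → multiplicity _≟ₗ_ (y ∷ k) (map (x ∷_) (listsOf j B))) (map suc (upTo B)))
    ≡⟨ sum-map-cong (λ x → trans (count-map _ (x ∷_) (listsOf j B)) (count-∧ˡ (does (y ≟ x)) _ (listsOf j B))) (map suc (upTo B)) ⟩
  sum (map (λ x → if does (y ≟ x) then multiplicity _≟ₗ_ k (listsOf j B) else 0) (map suc (upTo B)))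
    ≡⟨ cong (λ xs → sum (map (λ x → if does (y ≟ x) then multiplicity _≟ₗ_ k (listsOf j B) else 0) xs)) (letters≡interval B) ⟩
  sum (map (λ x → if does (y ≟ x) then multiplicity _≟ₗ_ k (listsOf j B) else 0) (interval 1 B))
    ≡⟨ sum-interval-point y _ 1 B 1≤y (s≤s y≤B) ⟩
  multiplicity _≟ₗ_ k (listsOf j B)
    ≡⟨ multiplicity-listsOf j B k k∈ ⟩
  χ (does (length k ≟ j)) ∎
  where open ≡-Reasoning

positive⇒∈[1,sum] : ∀ k → All (0 <_) k → All (_∈[1, sum k ]) k
positive⇒∈[1,sum] [] [] = []
positive⇒∈[1,sum] (y ∷ k) (0<y ∷ pos) =
  (0<y , m≤m+n y (sum k)) ∷ All.map (λ (1≤x , x≤) → 1≤x , ≤-trans x≤ (m≤n+m (sum k) y)) (positive⇒∈[1,sum] k pos)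

positive⇒length≤sum : ∀ k → All (0 <_) k → length k ≤ sum k
positive⇒length≤sum [] [] = z≤n
positive⇒length≤sum (y ∷ k) (0<y ∷ pos) = +-mono-≤ 0<y (positive⇒length≤sum k pos)

χ≡if : ∀ b → χ b ≡ (if b then 1 else 0)
χ≡if true = refl
χ≡if false = refl

multiplicity-compositions : ∀ n k → IsComposition n k → multiplicity _≟ₗ_ k (compositions n) ≡ 1
multiplicity-compositions .(sum k) k (pos , refl) = begin
  multiplicity _≟ₗ_ k (filter (isComposition? n) candidates)
    ≡⟨ cong (multiplicity _≟ₗ_ k) (filter≡filterᵇ (isComposition? n) candidates) ⟩
  multiplicity _≟ₗ_ k (filterᵇ (does ∘ isComposition? n) candidates)
    ≡⟨ multiplicity-filterᵇ _≟ₗ_ (does ∘ isComposition? n) k candidates ⟩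
  (if does (isComposition? n k) then multiplicity _≟ₗ_ k candidates else 0)
    ≡⟨ cong (λ b → if b then multiplicity _≟ₗ_ k candidates else 0) (dec-true (isComposition? n k) (pos , refl)) ⟩
  multiplicity _≟ₗ_ k candidates
    ≡⟨ count-concatMap _ (λ j → listsOf j n) (upTo (suc n)) ⟩
  sum (map (λ j → multiplicity _≟ₗ_ k (listsOf j n)) (upTo (suc n)))
    ≡⟨ sum-map-cong (λ j → trans (multiplicity-listsOf j n k (positive⇒∈[1,sum] k pos)) (χ≡if _)) (upTo (suc n)) ⟩
  sum (map (λ j → if does (length k ≟ j) then 1 else 0) (upTo (suc n)))
    ≡⟨ cong (λ js → sum (map (λ j → if does (length k ≟ j) then 1 else 0) js)) (upTo≡interval (suc n)) ⟩
  sum (map (λ j → if does (length k ≟ j) then 1 else 0) (interval 0 (suc n)))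
    ≡⟨ sum-interval-point (length k) 1 0 (suc n) z≤n (s≤s (positive⇒length≤sum k pos)) ⟩
  1 ∎
  where
  open ≡-Reasoning
  n = sum k
  candidates = concatMap (λ j → listsOf j n) (upTo (suc n))

sum-count-fibres : {A B : Set} (_≟_ : DecidableEquality B) (key : A → B) (p q : A → Bool) (xs : List A) (ys : List B) →
  (∀ x → multiplicity _≟_ (key x) ys ≡ χ (q x)) →
  sum (map (λ y → count (λ x → p x ∧ does (key x ≟ y)) xs) ys) ≡ count (λ x → p x ∧ q x) xs
sum-count-fibres _≟_ key p q xs ys mult = begin
  sum (map (λ y → count (λ x → p x ∧ does (key x ≟ y)) xs) ys)
    ≡⟨ sum-map-cong (λ y → count≡sum-χ _ xs) ys ⟩
  sum (map (λ y → sum (map (λ x → h x y) xs)) ys)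
    ≡⟨ sum-map-swap h xs ys ⟩
  sum (map (λ x → sum (map (h x) ys)) xs)
    ≡⟨ sum-map-cong per-x xs ⟩
  sum (map (χ ∘ (λ x → p x ∧ q x)) xs)
    ≡⟨ count≡sum-χ _ xs ⟨
  count (λ x → p x ∧ q x) xs ∎
  where
  open ≡-Reasoning
  h : _ → _ → ℕ
  h x y = χ (p x ∧ does (key x ≟ y))
  if-χ : ∀ b c → (if b then χ c else 0) ≡ χ (b ∧ c)
  if-χ true c = refl
  if-χ false c = refl
  per-x : ∀ x → sum (map (h x) ys) ≡ χ (p x ∧ q x)
  per-x x = trans (sym (count≡sum-χ _ ys))
    (trans (count-∧ˡ (p x) _ ys) (trans (cong (λ m → if p x then m else 0) (mult x)) (if-χ (p x) (q x))))

multiplicity-coarsenings : ∀ n γ β → IsComposition n β →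
  multiplicity _≟ₗ_ β (coarsenings n γ) ≡ χ (does (β ≽? γ))
multiplicity-coarsenings n γ β cβ = begin
  multiplicity _≟ₗ_ β (filter (_≽? γ) (compositions n))
    ≡⟨ cong (multiplicity _≟ₗ_ β) (filter≡filterᵇ (_≽? γ) (compositions n)) ⟩
  multiplicity _≟ₗ_ β (filterᵇ (does ∘ (_≽? γ)) (compositions n))
    ≡⟨ multiplicity-filterᵇ _≟ₗ_ (does ∘ (_≽? γ)) β (compositions n) ⟩
  (if does (β ≽? γ) then multiplicity _≟ₗ_ β (compositions n) else 0)
    ≡⟨ cong (λ m → if does (β ≽? γ) then m else 0) (multiplicity-compositions n β cβ) ⟩
  (if does (β ≽? γ) then 1 else 0)
    ≡⟨ χ≡if _ ⟨
  χ (does (β ≽? γ)) ∎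
  where open ≡-Reasoning

sum-Lstar-coarsenings : ∀ n α γ → sum α ≡ n → 1 ≤ n →
  sum (map (Lstar α) (coarsenings n γ)) ≡
  length (filter (λ T → standard? n T ×-dec (comp n (DesRS n T) ≽? γ)) (fillings α n))
sum-Lstar-coarsenings n α γ refl 1≤n = begin
  sum (map (Lstar α) (coarsenings n γ))
    ≡⟨ sum-map-cong (λ β → cong length (filter≡filterᵇ _ (fillings α n))) (coarsenings n γ) ⟩
  sum (map (λ β → count (λ T → standard T ∧ does (key T ≟ₗ β)) (fillings α n)) (coarsenings n γ))
    ≡⟨ sum-count-fibres _≟ₗ_ key standard (λ T → does (key T ≽? γ)) (fillings α n) (coarsenings n γ)
         (λ T → multiplicity-coarsenings n γ (key T) (comp-isComposition n 1≤n (λ i → rowOf (suc i) T ≤? rowOf i T))) ⟩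
  count (λ T → standard T ∧ does (key T ≽? γ)) (fillings α n)
    ≡⟨ cong length (filter≡filterᵇ _ (fillings α n)) ⟨
  length (filter (λ T → standard? n T ×-dec (key T ≽? γ)) (fillings α n)) ∎
  where
  open ≡-Reasoning
  key : List (List ℕ) → List ℕ
  key T = comp n (DesRS n T)
  standard : List (List ℕ) → Bool
  standard T = does (standard? n T)

IsRow : ℕ → ℕ → List ℕ → Set
IsRow B k r = length r ≡ k × All (_∈[1, B ]) r

IsFilling : List ℕ → ℕ → List (List ℕ) → Set
IsFilling α B T = Pointwise (IsRow B) α T

All-concatMap⁺ : {A B : Set} {P : A → Set} {Q : B → Set} (f : A → List B) {xs : List A} →
  All P xs → (∀ {x} → P x → All Q (f x)) → All Q (concatMap f xs)
All-concatMap⁺ f ps h = concat⁺ (map⁺ (All.map h ps))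

letters-∈[1,] : ∀ B → All (_∈[1, B ]) (map suc (upTo B))
letters-∈[1,] B =
  subst (All (_∈[1, B ])) (sym (letters≡interval B)) (All.map (λ (1≤x , x<) → 1≤x , ≤-pred x<) (All-interval 1 B))

listsOf-rows : ∀ k B → All (IsRow B k) (listsOf k B)
listsOf-rows zero B = (refl , []) ∷ []
listsOf-rows (suc k) B = All-concatMap⁺ _ (letters-∈[1,] B)
  (λ x∈ → map⁺ (All.map (λ (len , r∈) → cong suc len , x∈ ∷ r∈) (listsOf-rows k B)))

fillings-valid : ∀ α B → All (IsFilling α B) (fillings α B)
fillings-valid [] B = [] ∷ []
fillings-valid (k ∷ α) B = All-concatMap⁺ _ (listsOf-rows k B) (λ r-row → map⁺ (All.map (r-row ∷_) (fillings-valid α B)))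

multiplicity-fillings : ∀ α B T → IsFilling α B T → multiplicity _≟ₜ_ T (fillings α B) ≡ 1
multiplicity-fillings [] B [] [] = refl
multiplicity-fillings (k ∷ α) B (r ∷ T) ((len , r∈) ∷ T-fill) = begin
  multiplicity _≟ₜ_ (r ∷ T) (fillings (k ∷ α) B)
    ≡⟨ count-concatMap _ (λ r′ → map (r′ ∷_) (fillings α B)) (listsOf k B) ⟩
  sum (map (λ r′ → multiplicity _≟ₜ_ (r ∷ T) (map (r′ ∷_) (fillings α B))) (listsOf k B))
    ≡⟨ sum-map-cong (λ r′ → trans (count-map _ (r′ ∷_) (fillings α B)) (count-∧ˡ (does (r ≟ₗ r′)) _ (fillings α B))) (listsOf k B) ⟩
  sum (map (λ r′ → if does (r ≟ₗ r′) then multiplicity _≟ₜ_ T (fillings α B) else 0) (listsOf k B))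
    ≡⟨ cong (λ m → sum (map (λ r′ → if does (r ≟ₗ r′) then m else 0) (listsOf k B))) (multiplicity-fillings α B T T-fill) ⟩
  sum (map (λ r′ → if does (r ≟ₗ r′) then 1 else 0) (listsOf k B))
    ≡⟨ sum-map-cong (λ r′ → χ≡if (does (r ≟ₗ r′))) (listsOf k B) ⟨
  sum (map (χ ∘ (λ r′ → does (r ≟ₗ r′))) (listsOf k B))
    ≡⟨ count≡sum-χ _ (listsOf k B) ⟨
  multiplicity _≟ₗ_ r (listsOf k B)
    ≡⟨ multiplicity-listsOf k B r r∈ ⟩
  χ (does (length r ≟ k))
    ≡⟨ cong χ (dec-true (length r ≟ k) len) ⟩
  1 ∎
  where open ≡-Reasoning

IsFilling⇒entries : ∀ {α B T} → IsFilling α B T → All (All (_∈[1, B ])) T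
IsFilling⇒entries [] = []
IsFilling⇒entries ((_ , r∈) ∷ T-fill) = r∈ ∷ IsFilling⇒entries T-fill

IsFilling⇒rows-nonempty : ∀ {α B T} → All (0 <_) α → IsFilling α B T → All (λ r → 0 < length r) T
IsFilling⇒rows-nonempty [] [] = []
IsFilling⇒rows-nonempty (0<k ∷ pos) ((len , _) ∷ T-fill) = subst (0 <_) (sym len) 0<k ∷ IsFilling⇒rows-nonempty pos T-fill

-- Blocks of γ, all indices 0-based: part γ x = γ_{x+1}, the cells of block x
-- are offset γ x + 1, …, offset γ x + part γ x, and block γ j is the block of cell j.
part : List ℕ → ℕ → ℕ
part [] x = 0
part (g ∷ γ) zero = g
part (g ∷ γ) (suc x) = part γ x

offset : List ℕ → ℕ → ℕ
offset γ zero = 0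
offset [] (suc x) = 0
offset (g ∷ γ) (suc x) = g + offset γ x

block : List ℕ → ℕ → ℕ
block [] j = 0
block (g ∷ γ) j = if does (j ≤? g) then 0 else suc (block γ (j ∸ g))

block-offset : ∀ γ x c → x < length γ → c < part γ x → block γ (offset γ x + suc c) ≡ x
block-offset (g ∷ γ) zero c _ c<g rewrite dec-true (suc c ≤? g) c<g = refl
block-offset (g ∷ γ) (suc x) c (s≤s x<) c<
  rewrite dec-false (g + offset γ x + suc c ≤? g) (<⇒≱ (≤-<-trans (m≤m+n g (offset γ x)) (m<m+n (g + offset γ x) (s≤s z≤n))))
        | +-assoc g (offset γ x) (suc c) | m+n∸m≡n g (offset γ x + suc c)
  = cong suc (block-offset γ x c x< c<)

offset-decomposition : ∀ γ j → 1 ≤ j → j ≤ sum γ →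
  Σ ℕ λ x → Σ ℕ λ c → x < length γ × c < part γ x × j ≡ offset γ x + suc c
offset-decomposition [] j 1≤j j≤0 = ⊥-elim (1+n≰n (≤-trans 1≤j j≤0))
offset-decomposition (g ∷ γ) (suc c) _ j≤ with suc c ≤? g
... | yes j≤g = 0 , c , s≤s z≤n , j≤g , refl
... | no j≰g with offset-decomposition γ (suc c ∸ g) (m<n⇒0<n∸m (≰⇒> j≰g))
                    (≤-trans (∸-monoˡ-≤ g j≤) (≤-reflexive (m+n∸m≡n g (sum γ))))
...   | x , c′ , x< , c′< , e = suc x , c′ , s≤s x< , c′< ,
        trans (sym (m+[n∸m]≡n (<⇒≤ (≰⇒> j≰g)))) (trans (cong (g +_) e) (sym (+-assoc g (offset γ x) (suc c′))))

offset+part≤sum : ∀ γ x → x < length γ → offset γ x + part γ x ≤ sum γ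
offset+part≤sum (g ∷ γ) zero _ = m≤m+n g (sum γ)
offset+part≤sum (g ∷ γ) (suc x) (s≤s x<) =
  ≤-trans (≤-reflexive (+-assoc g (offset γ x) (part γ x))) (+-monoʳ-≤ g (offset+part≤sum γ x x<))

offset+part≤offset : ∀ γ x y → x < y → y < length γ → offset γ x + part γ x ≤ offset γ y
offset+part≤offset (g ∷ γ) zero (suc y) _ _ = m≤m+n g (offset γ y)
offset+part≤offset (g ∷ γ) (suc x) (suc y) (s≤s x<y) (s≤s y<) =
  ≤-trans (≤-reflexive (+-assoc g (offset γ x) (part γ x))) (+-monoʳ-≤ g (offset+part≤offset γ x y x<y y<))

block-mono : ∀ γ {i j} → i ≤ j → block γ i ≤ block γ j
block-mono [] i≤j = z≤n
block-mono (g ∷ γ) {i} {j} i≤j with i ≤? g | j ≤? g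
... | yes i≤g | _ rewrite dec-true (i ≤? g) i≤g = z≤n
... | no i≰g | yes j≤g = ⊥-elim (i≰g (≤-trans i≤j j≤g))
... | no i≰g | no j≰g rewrite dec-false (i ≤? g) i≰g | dec-false (j ≤? g) j≰g = s≤s (block-mono γ (∸-monoˡ-≤ g i≤j))

does-≟-block : ∀ γ x v → x < length γ → 1 ≤ v → v ≤ sum γ →
  does (x ≟ block γ v) ≡ does (offset γ x <? v) ∧ does (v ≤? offset γ x + part γ x)
does-≟-block γ x v x< 1≤v v≤ with offset-decomposition γ v 1≤v v≤
... | y , c , y< , c< , refl rewrite block-offset γ y c y< c< with <-cmp x y
... | tri≈ _ refl _
  rewrite dec-true (x ≟ x) refl | dec-true (offset γ x <? offset γ x + suc c) (m<m+n (offset γ x) (s≤s z≤n))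
        | dec-true (offset γ x + suc c ≤? offset γ x + part γ x) (+-monoʳ-≤ (offset γ x) c<) = refl
... | tri< x<y _ _
  rewrite dec-false (x ≟ y) (<⇒≢ x<y)
        | dec-false (offset γ y + suc c ≤? offset γ x + part γ x)
            (λ v≤ → <⇒≱ (≤-trans (m<m+n (offset γ y) (s≤s z≤n)) v≤) (offset+part≤offset γ x y x<y y<))
  = sym (∧-zeroʳ _)
... | tri> _ _ y<x
  rewrite dec-false (x ≟ y) (λ e → <⇒≢ y<x (sym e))
        | dec-false (offset γ x <? offset γ y + suc c)
            (λ o< → <⇒≱ o< (≤-trans (+-monoʳ-≤ (offset γ y) c<) (offset+part≤offset γ y x y<x x<))) = refl

∈ᵇ-setAux≡block-change : ∀ acc g γ i → 1 ≤ i → i < sum (g ∷ γ) →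
  (acc + i) ∈ᵇ setAux acc (g ∷ γ) ≡ not (does (block (g ∷ γ) i ≟ block (g ∷ γ) (suc i)))
∈ᵇ-setAux≡block-change acc g [] i _ i<
  rewrite dec-true (i ≤? g) (≤-trans (<⇒≤ i<) (≤-reflexive (+-identityʳ g)))
        | dec-true (suc i ≤? g) (≤-trans i< (≤-reflexive (+-identityʳ g))) = refl
∈ᵇ-setAux≡block-change acc g (g′ ∷ γ) i 1≤i i< with <-cmp i g
... | tri< i<g _ _
  rewrite dec-false (acc + i ≟ acc + g) (λ e → <-irrefl (+-cancelˡ-≡ acc i g e) i<g)
        | ∉-setAux-below (acc + g) g′ γ (acc + i) (≤-trans (+-monoʳ-< acc i<g) (m≤m+n (acc + g) g′))
        | dec-true (i ≤? g) (<⇒≤ i<g) | dec-true (suc i ≤? g) i<g = refl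
... | tri≈ _ refl _
  rewrite dec-true (acc + i ≟ acc + i) refl | dec-true (i ≤? i) ≤-refl | dec-false (suc i ≤? i) 1+n≰n = refl
... | tri> _ _ g<i
  rewrite dec-false (acc + i ≟ acc + g) (λ e → <-irrefl (sym (+-cancelˡ-≡ acc i g e)) g<i)
        | dec-false (i ≤? g) (<⇒≱ g<i) | dec-false (suc i ≤? g) (<⇒≱ (m<n⇒m<1+n g<i))
        | +-∸-assoc 1 (<⇒≤ g<i)
  = trans (cong (_∈ᵇ setAux (acc + g) (g′ ∷ γ)) (trans (cong (acc +_) (sym (m+[n∸m]≡n (<⇒≤ g<i)))) (sym (+-assoc acc g (i ∸ g)))))
      (∈ᵇ-setAux≡block-change (acc + g) g′ γ (i ∸ g) (m<n⇒0<n∸m g<i)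
        (≤-trans (∸-monoˡ-< i< (<⇒≤ g<i)) (≤-reflexive (m+n∸m≡n g (sum (g′ ∷ γ))))))

∈ᵇ-setOf≡block-change : ∀ γ i → 1 ≤ i → i < sum γ → i ∈ᵇ setOf γ ≡ not (does (block γ i ≟ block γ (suc i)))
∈ᵇ-setOf≡block-change (g ∷ γ) i = ∈ᵇ-setAux≡block-change 0 g γ i

interval-++ : ∀ k a b → interval k (a + b) ≡ interval k a ++ interval (k + a) b
interval-++ k zero b = cong (λ k′ → interval k′ b) (sym (+-identityʳ k))
interval-++ k (suc a) b = cong (k ∷_) (trans (interval-++ (suc k) a b) (cong (λ k′ → interval (suc k) a ++ interval k′ b) (sym (+-suc k a))))

count-interval-true : (p : ℕ → Bool) (k m : ℕ) → (∀ v → k ≤ v → v < k + m → p v ≡ true) → count p (interval k m) ≡ m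
count-interval-true p k m h =
  trans (count-cong-local (All.map (λ { {v} (k≤v , v<) → h v k≤v v< }) (All-interval k m)))
        (trans (length-filter-true (interval k m)) (length-interval k m))
  where
  length-filter-true : ∀ xs → count (λ _ → true) xs ≡ length xs
  length-filter-true [] = refl
  length-filter-true (x ∷ xs) = cong suc (length-filter-true xs)

count-interval-false : (p : ℕ → Bool) (k m : ℕ) → (∀ v → k ≤ v → v < k + m → p v ≡ false) → count p (interval k m) ≡ 0
count-interval-false p k m h =
  trans (count-cong-local (All.map (λ { {v} (k≤v , v<) → h v k≤v v< }) (All-interval k m))) (count-false (interval k m))

count-window : (p : ℕ → Bool) (n a d : ℕ) → a + d ≤ n →
  (∀ v → 1 ≤ v → v ≤ n → p v ≡ does (a <? v) ∧ does (v ≤? a + d)) → count p (interval 1 n) ≡ d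
count-window p n a d a+d≤n window = begin
  count p (interval 1 n)
    ≡⟨ cong (count p ∘ interval 1) (sym n≡) ⟩
  count p (interval 1 (a + (d + e)))
    ≡⟨ cong (count p) (trans (interval-++ 1 a (d + e)) (cong (interval 1 a ++_) (interval-++ (suc a) d e))) ⟩
  count p (interval 1 a ++ interval (suc a) d ++ interval (suc a + d) e)
    ≡⟨ trans (count-++ p (interval 1 a) _) (cong (count p (interval 1 a) +_) (count-++ p (interval (suc a) d) _)) ⟩
  count p (interval 1 a) + (count p (interval (suc a) d) + count p (interval (suc a + d) e))
    ≡⟨ cong₂ (λ x y → x + (y + count p (interval (suc a + d) e))) before inside ⟩
  d + count p (interval (suc a + d) e)
    ≡⟨ cong (d +_) after ⟩
  d + 0
    ≡⟨ +-identityʳ d ⟩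
  d ∎
  where
  open ≡-Reasoning
  e = n ∸ (a + d)
  n≡ : a + (d + e) ≡ n
  n≡ = trans (sym (+-assoc a d e)) (m+[n∸m]≡n a+d≤n)
  before : count p (interval 1 a) ≡ 0
  before = count-interval-false p 1 a (λ v 1≤v v≤a → trans (window v 1≤v (≤-trans (≤-pred v≤a) (≤-trans (m≤m+n a d) a+d≤n)))
    (cong (_∧ does (v ≤? a + d)) (dec-false (a <? v) (λ a<v → <⇒≱ a<v (≤-pred v≤a)))))
  inside : count p (interval (suc a) d) ≡ d
  inside = count-interval-true p (suc a) d (λ v a<v v≤ → trans (window v (≤-trans (s≤s z≤n) a<v) (≤-trans (≤-pred v≤) a+d≤n))
    (trans (cong (_∧ does (v ≤? a + d)) (dec-true (a <? v) a<v)) (dec-true (v ≤? a + d) (≤-pred v≤))))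
  after : count p (interval (suc a + d) e) ≡ 0
  after = count-interval-false p (suc a + d) e (λ v a+d<v v< → trans (window v (≤-trans (s≤s z≤n) a+d<v)
      (≤-trans (≤-pred v<) (≤-reflexive (m+[n∸m]≡n a+d≤n))))
    (trans (cong (does (a <? v) ∧_) (dec-false (v ≤? a + d) (<⇒≱ a+d<v))) (∧-zeroʳ _)))

count-block : ∀ γ x → x < length γ → count (λ v → does (x ≟ block γ v)) (interval 1 (sum γ)) ≡ part γ x
count-block γ x x< = count-window _ (sum γ) (offset γ x) (part γ x) (offset+part≤sum γ x x<) (λ v → does-≟-block γ x v x<)

occ≡count : ∀ x xs → occ x xs ≡ count (λ y → does (x ≟ y)) xs
occ≡count x xs = cong length (filter≡filterᵇ (x ≟_) xs)

occ-∷ : ∀ x y xs → occ x (y ∷ xs) ≡ χ (does (x ≟ y)) + occ x xs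
occ-∷ x y xs = trans (occ≡count x (y ∷ xs)) (trans (count-∷ _ y xs) (cong (χ (does (x ≟ y)) +_) (sym (occ≡count x xs))))

occ-++ : ∀ x xs ys → occ x (xs ++ ys) ≡ occ x xs + occ x ys
occ-++ x xs ys = trans (occ≡count x (xs ++ ys)) (trans (count-++ _ xs ys) (sym (cong₂ _+_ (occ≡count x xs) (occ≡count x ys))))

∈ᵇ-++ : ∀ v xs ys → v ∈ᵇ (xs ++ ys) ≡ v ∈ᵇ xs ∨ v ∈ᵇ ys
∈ᵇ-++ v [] ys = refl
∈ᵇ-++ v (y ∷ xs) ys = trans (cong (does (v ≟ y) ∨_) (∈ᵇ-++ v xs ys)) (sym (∨-assoc (does (v ≟ y)) (v ∈ᵇ xs) (v ∈ᵇ ys)))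

∈ᵇ⇒1≤occ : ∀ v xs → v ∈ᵇ xs ≡ true → 1 ≤ occ v xs
∈ᵇ⇒1≤occ v (y ∷ xs) v∈ rewrite occ-∷ v y xs with v ≟ y
... | yes refl rewrite dec-true (v ≟ v) refl = s≤s z≤n
... | no v≢y rewrite dec-false (v ≟ y) v≢y = ∈ᵇ⇒1≤occ v xs v∈

1≤occ⇒∈ᵇ : ∀ v xs → 1 ≤ occ v xs → v ∈ᵇ xs ≡ true
1≤occ⇒∈ᵇ v (y ∷ xs) 1≤occ rewrite occ-∷ v y xs with v ≟ y
... | yes refl rewrite dec-true (v ≟ v) refl = refl
... | no v≢y rewrite dec-false (v ≟ y) v≢y = 1≤occ⇒∈ᵇ v xs 1≤occ

∉ᵇ⇒occ≡0 : ∀ v xs → v ∈ᵇ xs ≡ false → occ v xs ≡ 0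
∉ᵇ⇒occ≡0 v xs v∉ with occ v xs in e
... | zero = refl
... | suc _ with trans (sym (1≤occ⇒∈ᵇ v xs (subst (1 ≤_) (sym e) (s≤s z≤n)))) v∉
...   | ()

occ≡0⇒∉ᵇ : ∀ v xs → occ v xs ≡ 0 → v ∈ᵇ xs ≡ false
occ≡0⇒∉ᵇ v xs occ≡0 with v ∈ᵇ xs in e
... | false = refl
... | true = ⊥-elim (1+n≰n (≤-trans (∈ᵇ⇒1≤occ v xs e) (≤-reflexive occ≡0)))

occ-self : ∀ r → All (λ x → 1 ≤ occ x r) r
occ-self [] = []
occ-self (y ∷ r) =
  ∈ᵇ⇒1≤occ y (y ∷ r) (cong (_∨ (y ∈ᵇ r)) (dec-true (y ≟ y) refl)) ∷
  All.map (λ {x} 1≤occ → ≤-trans 1≤occ (≤-trans (m≤n+m (occ x r) _) (≤-reflexive (sym (occ-∷ x y r))))) (occ-self r)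

linked-head-< : ∀ {y r} → Linked _<_ (y ∷ r) → All (y <_) r
linked-head-< {r = []} _ = []
linked-head-< {r = z ∷ r} (y<z ∷ l) = Linked⇒All <-trans y<z l

occ-below-head : ∀ x r → All (x <_) r → occ x r ≡ 0
occ-below-head x [] [] = refl
occ-below-head x (z ∷ r) (x<z ∷ x<r) rewrite occ-∷ x z r | dec-false (x ≟ z) (<⇒≢ x<z) = occ-below-head x r x<r

occ-strict≤1 : ∀ x r → Linked _<_ r → occ x r ≤ 1
occ-strict≤1 x [] _ = z≤n
occ-strict≤1 x (y ∷ r) l rewrite occ-∷ x y r with x ≟ y
... | yes refl rewrite dec-true (x ≟ x) refl | occ-below-head x r (linked-head-< l) = ≤-refl
... | no x≢y rewrite dec-false (x ≟ y) x≢y = occ-strict≤1 x r (Linked.tail l)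

Linked-map-local : {V : ℕ → Set} {R R′ : ℕ → ℕ → Set} (f : ℕ → ℕ) {xs : List ℕ} → Linked R xs → All V xs →
  (∀ {a b} → V a → V b → R a b → R′ (f a) (f b)) → Linked R′ (map f xs)
Linked-map-local f [] [] h = []
Linked-map-local f [-] (_ ∷ []) h = [-]
Linked-map-local f (Rxy ∷ l) (vx ∷ vy ∷ vs) h = h vx vy Rxy ∷ Linked-map-local f l (vy ∷ vs) h

rowOf-∷-∈ : ∀ {v r T} → v ∈ᵇ r ≡ true → rowOf v (r ∷ T) ≡ 0
rowOf-∷-∈ {v} {r} {T} v∈ = cong (λ b → if b then 0 else suc (rowOf v T)) v∈

count≡sum-occ : (p : ℕ → Bool) (n : ℕ) (L : List ℕ) → All (_∈[1, n ]) L →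
  count p L ≡ sum (map (λ v → if p v then occ v L else 0) (interval 1 n))
count≡sum-occ p n [] [] = sym (trans (sum-map-cong if-same (interval 1 n)) (sum-map-zero (interval 1 n)))
  where
  if-same : ∀ v → (if p v then 0 else 0) ≡ 0
  if-same v with p v
  ... | true = refl
  ... | false = refl
count≡sum-occ p n (y ∷ L) ((1≤y , y≤n) ∷ L∈) = begin
  count p (y ∷ L)
    ≡⟨ count-∷ p y L ⟩
  χ (p y) + count p L
    ≡⟨ cong₂ _+_ (sym (sum-interval-point y (χ (p y)) 1 n 1≤y (s≤s y≤n))) (count≡sum-occ p n L L∈) ⟩
  sum (map (λ v → if does (y ≟ v) then χ (p y) else 0) (interval 1 n)) + sum (map (λ v → if p v then occ v L else 0) (interval 1 n))
    ≡⟨ sum-map-+ _ _ (interval 1 n) ⟨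
  sum (map (λ v → (if does (y ≟ v) then χ (p y) else 0) + (if p v then occ v L else 0)) (interval 1 n))
    ≡⟨ sum-map-cong split (interval 1 n) ⟨
  sum (map (λ v → if p v then occ v (y ∷ L) else 0) (interval 1 n)) ∎
  where
  open ≡-Reasoning
  split : ∀ v → (if p v then occ v (y ∷ L) else 0) ≡ (if does (y ≟ v) then χ (p y) else 0) + (if p v then occ v L else 0)
  split v rewrite occ-∷ v y L with y ≟ v
  ... | yes refl rewrite dec-true (y ≟ y) refl with p y
  ...   | true = refl
  ...   | false = refl
  split v | no y≢v rewrite dec-false (v ≟ y) (y≢v ∘ sym) | dec-false (y ≟ v) y≢v with p v
  ...   | true = refl
  ...   | false = refl

count-by-occ : (p q : ℕ → Bool) (n : ℕ) (L : List ℕ) → All (_∈[1, n ]) L →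
  (∀ v → 1 ≤ v → v ≤ n → (if p v then occ v L else 0) ≡ χ (q v)) → count p L ≡ count q (interval 1 n)
count-by-occ p q n L L∈ per-cell =
  trans (count≡sum-occ p n L L∈)
    (trans (sum-map-cong-local (All.map (λ { {v} (1≤v , v<) → per-cell v 1≤v (≤-pred v<) }) (All-interval 1 n)))
      (sym (count≡sum-χ q (interval 1 n))))

does-true⇒ : {A : Set} (a? : Dec A) → does a? ≡ true → A
does-true⇒ (yes a) _ = a

m+n≡1⇒m≡0 : ∀ m n → m + n ≡ 1 → 1 ≤ n → m ≡ 0
m+n≡1⇒m≡0 zero n _ _ = refl
m+n≡1⇒m≡0 (suc m) n m+n≡1 1≤n = ⊥-elim (1+n≰n (≤-trans 1≤n (≤-reflexive (m+n≡0⇒n≡0 m (suc-injective m+n≡1)))))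

rowOf-++-∈ : ∀ v pre post → v ∈ᵇ concat pre ≡ true → rowOf v (pre ++ post) < length pre
rowOf-++-∈ v (r ∷ pre) post v∈ with v ∈ᵇ r in v∈r
... | true = s≤s z≤n
... | false = s≤s (rowOf-++-∈ v pre post (trans (sym (trans (∈ᵇ-++ v r (concat pre)) (cong (_∨ v ∈ᵇ concat pre) v∈r))) v∈))

rowOf-++-<⇒∈ : ∀ v pre post → rowOf v (pre ++ post) < length pre → v ∈ᵇ concat pre ≡ true
rowOf-++-<⇒∈ v (r ∷ pre) post row< with v ∈ᵇ r in v∈r
... | true = trans (∈ᵇ-++ v r (concat pre)) (cong (_∨ v ∈ᵇ concat pre) v∈r)
... | false = trans (∈ᵇ-++ v r (concat pre)) (trans (cong (_∨ v ∈ᵇ concat pre) v∈r) (rowOf-++-<⇒∈ v pre post (≤-pred row<)))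

rowOf-++-∉ : ∀ v pre post → v ∈ᵇ concat pre ≡ false → rowOf v (pre ++ post) ≡ length pre + rowOf v post
rowOf-++-∉ v [] post _ = refl
rowOf-++-∉ v (r ∷ pre) post v∉ with v ∈ᵇ r in v∈r
... | true with trans (sym v∉) (trans (∈ᵇ-++ v r (concat pre)) (cong (_∨ v ∈ᵇ concat pre) v∈r))
...   | ()
rowOf-++-∉ v (r ∷ pre) post v∉ | false =
  cong suc (rowOf-++-∉ v pre post (trans (sym (cong (_∨ v ∈ᵇ concat pre) v∈r)) (trans (sym (∈ᵇ-++ v r (concat pre))) v∉)))

firstColumn-map : (f : ℕ → ℕ) (T : List (List ℕ)) → firstColumn (map (map f) T) ≡ map f (firstColumn T)
firstColumn-map f [] = refl
firstColumn-map f ([] ∷ T) = firstColumn-map f T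
firstColumn-map f ((x ∷ r) ∷ T) = cong (f x ∷_) (firstColumn-map f T)

-- A row-strict row contains each letter at most once, so the labels of a whole row
-- are determined by the rows below it.
module Standardization (γ : List ℕ) where

  letter : ℕ → ℕ
  letter j = suc (block γ j)

  label : List ℕ → ℕ → ℕ
  label seen x = offset γ (x ∸ 1) + suc (occ x seen)

  standardizeFrom : List ℕ → List (List ℕ) → List (List ℕ)
  standardizeFrom seen [] = []
  standardizeFrom seen (r ∷ T) = map (label seen) r ∷ standardizeFrom (seen ++ r) T

  standardize : List (List ℕ) → List (List ℕ)
  standardize = standardizeFrom []

  destandardize : List (List ℕ) → List (List ℕ)
  destandardize = map (map letter)

  record ContentSplit (seen : List ℕ) (T : List (List ℕ)) : Set where
    constructor content-split
    field occ-split : ∀ x → x < length γ → occ (suc x) seen + occ (suc x) (concat T) ≡ part γ x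
  open ContentSplit

  Pending : List ℕ → ℕ → Set
  Pending seen x = Σ ℕ λ x₀ → x ≡ suc x₀ × x₀ < length γ × occ x seen < part γ x₀

  ContentSplit-step : ∀ {seen r T} → ContentSplit seen (r ∷ T) → ContentSplit (seen ++ r) T
  ContentSplit-step {seen} {r} {T} split = content-split λ x x< → begin
    occ (suc x) (seen ++ r) + occ (suc x) (concat T)      ≡⟨ cong (_+ occ (suc x) (concat T)) (occ-++ (suc x) seen r) ⟩
    occ (suc x) seen + occ (suc x) r + occ (suc x) (concat T) ≡⟨ +-assoc (occ (suc x) seen) _ _ ⟩
    occ (suc x) seen + (occ (suc x) r + occ (suc x) (concat T)) ≡⟨ cong (occ (suc x) seen +_) (occ-++ (suc x) r (concat T)) ⟨
    occ (suc x) seen + occ (suc x) (concat (r ∷ T))       ≡⟨ occ-split split x x< ⟩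
    part γ x                                              ∎
    where open ≡-Reasoning

  row-pending : ∀ {seen r T} → ContentSplit seen (r ∷ T) → All (_∈[1, length γ ]) r → All (Pending seen) r
  row-pending {seen} {r} {T} split r∈ = All.map pending (All.zip (r∈ , occ-self r))
    where
    pending : ∀ {x} → x ∈[1, length γ ] × 1 ≤ occ x r → Pending seen x
    pending {suc x₀} ((_ , x₀<) , 1≤occ) = x₀ , refl , x₀< , (begin-strict
      occ (suc x₀) seen                                             <⟨ m<m+n _ 1≤occ ⟩
      occ (suc x₀) seen + occ (suc x₀) r                            ≤⟨ +-monoʳ-≤ (occ (suc x₀) seen) (m≤m+n _ _) ⟩
      occ (suc x₀) seen + (occ (suc x₀) r + occ (suc x₀) (concat T)) ≡⟨ cong (occ (suc x₀) seen +_) (occ-++ (suc x₀) r (concat T)) ⟨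
      occ (suc x₀) seen + occ (suc x₀) (concat (r ∷ T))             ≡⟨ occ-split split x₀ x₀< ⟩
      part γ x₀                                                     ∎)
      where open ≤-Reasoning

  letter-label : ∀ seen {x} → Pending seen x → letter (label seen x) ≡ x
  letter-label seen (x₀ , refl , x₀< , occ<) = cong suc (block-offset γ x₀ (occ (suc x₀) seen) x₀< occ<)

  label-∈[1,sum] : ∀ seen {x} → Pending seen x → label seen x ∈[1, sum γ ]
  label-∈[1,sum] seen (x₀ , refl , x₀< , occ<) =
    ≤-trans (s≤s z≤n) (m≤n+m (suc (occ (suc x₀) seen)) (offset γ x₀)) ,
    ≤-trans (+-monoʳ-≤ (offset γ x₀) occ<) (offset+part≤sum γ x₀ x₀<)

  label-< : ∀ s s′ {x y} → Pending s x → Pending s′ y → x < y → label s x < label s′ y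
  label-< s s′ (x₀ , refl , _ , occ<) (y₀ , refl , y₀< , _) (s≤s x₀<y₀) = begin-strict
    offset γ x₀ + suc (occ (suc x₀) s)   ≤⟨ +-monoʳ-≤ (offset γ x₀) occ< ⟩
    offset γ x₀ + part γ x₀              ≤⟨ offset+part≤offset γ x₀ y₀ x₀<y₀ y₀< ⟩
    offset γ y₀                          <⟨ m<m+n (offset γ y₀) (s≤s z≤n) ⟩
    offset γ y₀ + suc (occ (suc y₀) s′)  ∎
    where open ≤-Reasoning

  label-<-same-letter : ∀ seen x r → label seen x < label (seen ++ x ∷ r) x
  label-<-same-letter seen x r = +-monoʳ-< (offset γ (x ∸ 1)) (s≤s (begin-strict
    occ x seen                  <⟨ m<m+n (occ x seen) (All.head (occ-self (x ∷ r))) ⟩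
    occ x seen + occ x (x ∷ r)  ≡⟨ occ-++ x seen (x ∷ r) ⟨
    occ x (seen ++ x ∷ r)       ∎))
    where open ≤-Reasoning

  standardizeFrom-IsFilling : ∀ {α seen T} → IsFilling α (length γ) T → ContentSplit seen T →
    IsFilling α (sum γ) (standardizeFrom seen T)
  standardizeFrom-IsFilling [] _ = []
  standardizeFrom-IsFilling {seen = seen} (_∷_ {y = r} (len , r∈) T-fill) split =
    (trans (length-map (label seen) r) len , map⁺ (All.map (label-∈[1,sum] seen) (row-pending split r∈)))
    ∷ standardizeFrom-IsFilling T-fill (ContentSplit-step split)

  destandardize-standardizeFrom : ∀ {seen T} → ContentSplit seen T → All (All (_∈[1, length γ ])) T →
    destandardize (standardizeFrom seen T) ≡ T
  destandardize-standardizeFrom {T = []} _ [] = refl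
  destandardize-standardizeFrom {seen} {r ∷ T} split (r∈ ∷ T∈) =
    cong₂ _∷_ (trans (sym (map-∘ r)) (map-id-local (All.map (letter-label seen) (row-pending split r∈))))
      (destandardize-standardizeFrom (ContentSplit-step split) T∈)

  standardizeFrom-rows : ∀ {seen T} → ContentSplit seen T → All (All (_∈[1, length γ ])) T →
    All (Linked _<_) T → All (Linked _<_) (standardizeFrom seen T)
  standardizeFrom-rows {T = []} _ [] [] = []
  standardizeFrom-rows {seen} {r ∷ T} split (r∈ ∷ T∈) (r< ∷ T<) =
    Linked-map-local (label seen) r< (row-pending split r∈) (label-< seen seen)
    ∷ standardizeFrom-rows (ContentSplit-step split) T∈ T<

  standardizeFrom-firstColumn : ∀ {seen T} → All (λ r → 0 < length r) T → ContentSplit seen T →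
    All (All (_∈[1, length γ ])) T → Linked _≤_ (firstColumn T) → Linked _<_ (firstColumn (standardizeFrom seen T))
  standardizeFrom-firstColumn {T = []} _ _ _ _ = []
  standardizeFrom-firstColumn {T = [] ∷ T} (() ∷ _) _ _ _
  standardizeFrom-firstColumn {T = (x ∷ r) ∷ []} _ _ _ _ = [-]
  standardizeFrom-firstColumn {T = (x ∷ r) ∷ [] ∷ T} (_ ∷ () ∷ _) _ _ _
  standardizeFrom-firstColumn {seen} {(x ∷ r) ∷ (y ∷ r′) ∷ T} (_ ∷ nonempty) split (r∈ ∷ T∈) (x≤y ∷ column) =
    first-labels ∷ standardizeFrom-firstColumn nonempty split′ T∈ column
    where
    split′ = ContentSplit-step split
    first-labels : label seen x < label (seen ++ x ∷ r) y
    first-labels with m≤n⇒m<n∨m≡n x≤y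
    ... | inj₁ x<y = label-< seen (seen ++ x ∷ r) (All.head (row-pending split r∈)) (All.head (row-pending split′ (All.head T∈))) x<y
    ... | inj₂ refl = label-<-same-letter seen x r

  module _ {x₀ c : ℕ} (x₀< : x₀ < length γ) (c< : c < part γ x₀) where

    does-≟-label : ∀ seen {y} → Pending seen y →
      does (offset γ x₀ + suc c ≟ label seen y) ≡ does (suc x₀ ≟ y) ∧ does (occ (suc x₀) seen ≟ c)
    does-≟-label seen (y₀ , refl , y₀< , occ<) =
      does-⇔ (mk⇔ to from) (offset γ x₀ + suc c ≟ label seen (suc y₀)) ((suc x₀ ≟ suc y₀) ×-dec (occ (suc x₀) seen ≟ c))
      where
      to : offset γ x₀ + suc c ≡ label seen (suc y₀) → suc x₀ ≡ suc y₀ × occ (suc x₀) seen ≡ c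
      to e with trans (sym (block-offset γ x₀ c x₀< c<)) (trans (cong (block γ) e) (block-offset γ y₀ (occ (suc y₀) seen) y₀< occ<))
      ... | refl = refl , sym (suc-injective (+-cancelˡ-≡ (offset γ x₀) (suc c) _ e))
      from : suc x₀ ≡ suc y₀ × occ (suc x₀) seen ≡ c → offset γ x₀ + suc c ≡ label seen (suc y₀)
      from (refl , e) = cong (λ k → offset γ x₀ + suc k) (sym e)

    occ-labels : ∀ seen r → All (Pending seen) r →
      occ (offset γ x₀ + suc c) (map (label seen) r) ≡ (if does (occ (suc x₀) seen ≟ c) then occ (suc x₀) r else 0)
    occ-labels seen r pending = begin
      occ (offset γ x₀ + suc c) (map (label seen) r)
        ≡⟨ trans (occ≡count _ (map (label seen) r)) (count-map _ (label seen) r) ⟩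
      count (λ y → does (offset γ x₀ + suc c ≟ label seen y)) r
        ≡⟨ count-cong-local (All.map (λ {y} p → trans (does-≟-label seen p) (∧-comm (does (suc x₀ ≟ y)) _)) pending) ⟩
      count (λ y → does (occ (suc x₀) seen ≟ c) ∧ does (suc x₀ ≟ y)) r
        ≡⟨ count-∧ˡ (does (occ (suc x₀) seen ≟ c)) _ r ⟩
      (if does (occ (suc x₀) seen ≟ c) then count (λ y → does (suc x₀ ≟ y)) r else 0)
        ≡⟨ cong (λ k → if does (occ (suc x₀) seen ≟ c) then k else 0) (occ≡count (suc x₀) r) ⟨
      (if does (occ (suc x₀) seen ≟ c) then occ (suc x₀) r else 0) ∎
      where open ≡-Reasoning

    ∈ᵇ-labels : ∀ seen r → All (Pending seen) r →
      (offset γ x₀ + suc c) ∈ᵇ map (label seen) r ≡ suc x₀ ∈ᵇ r ∧ does (occ (suc x₀) seen ≟ c)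
    ∈ᵇ-labels seen [] [] = refl
    ∈ᵇ-labels seen (y ∷ r) (p ∷ ps) =
      trans (cong₂ _∨_ (does-≟-label seen p) (∈ᵇ-labels seen r ps))
        (sym (∧-distribʳ-∨ (does (occ (suc x₀) seen ≟ c)) (does (suc x₀ ≟ y)) (suc x₀ ∈ᵇ r)))

    occ-label-used : ∀ {seen T} → ContentSplit seen T → All (All (_∈[1, length γ ])) T → c < occ (suc x₀) seen →
      occ (offset γ x₀ + suc c) (concat (standardizeFrom seen T)) ≡ 0
    occ-label-used {T = []} _ [] _ = refl
    occ-label-used {seen} {r ∷ T} split (r∈ ∷ T∈) c<occ = begin
      occ ℓ (map (label seen) r ++ concat (standardizeFrom (seen ++ r) T))
        ≡⟨ occ-++ ℓ (map (label seen) r) _ ⟩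
      occ ℓ (map (label seen) r) + occ ℓ (concat (standardizeFrom (seen ++ r) T))
        ≡⟨ cong₂ _+_ this-row (occ-label-used (ContentSplit-step split) T∈ c<occ′) ⟩
      0 ∎
      where
      open ≡-Reasoning
      ℓ = offset γ x₀ + suc c
      this-row : occ ℓ (map (label seen) r) ≡ 0
      this-row = trans (occ-labels seen r (row-pending split r∈))
        (cong (λ b → if b then occ (suc x₀) r else 0) (dec-false (occ (suc x₀) seen ≟ c) (λ e → <-irrefl (sym e) c<occ)))
      c<occ′ : c < occ (suc x₀) (seen ++ r)
      c<occ′ = <-≤-trans c<occ (≤-trans (m≤m+n _ _) (≤-reflexive (sym (occ-++ (suc x₀) seen r))))

    occ-label-fresh : ∀ {seen T} → ContentSplit seen T → All (All (_∈[1, length γ ])) T → All (Linked _<_) T →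
      occ (suc x₀) seen ≤ c → occ (offset γ x₀ + suc c) (concat (standardizeFrom seen T)) ≡ 1
    occ-label-fresh {seen} {[]} split _ _ occ≤c =
      ⊥-elim (<⇒≱ c< (subst (_≤ c) (trans (sym (+-identityʳ _)) (occ-split split x₀ x₀<)) occ≤c))
    occ-label-fresh {seen} {r ∷ T} split (r∈ ∷ T∈) (r< ∷ T<) occ≤c =
      trans (occ-++ ℓ (map (label seen) r) _)
        (trans (cong (_+ rest) (occ-labels seen r (row-pending split r∈)))
          (by-occurrences (occ (suc x₀) r) refl (occ-strict≤1 (suc x₀) r r<)))
      where
      ℓ = offset γ x₀ + suc c
      split′ = ContentSplit-step split
      rest = occ ℓ (concat (standardizeFrom (seen ++ r) T))
      b = does (occ (suc x₀) seen ≟ c)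
      occ′ : ∀ {k} → occ (suc x₀) r ≡ k → occ (suc x₀) (seen ++ r) ≡ occ (suc x₀) seen + k
      occ′ e = trans (occ-++ (suc x₀) seen r) (cong (occ (suc x₀) seen +_) e)
      by-occurrences : ∀ k → occ (suc x₀) r ≡ k → k ≤ 1 → (if b then occ (suc x₀) r else 0) + rest ≡ 1
      by-occurrences zero e _ with b
      ... | true = trans (cong (_+ rest) e) (occ-label-fresh split′ T∈ T< (subst (_≤ c) (sym (trans (occ′ e) (+-identityʳ _))) occ≤c))
      ... | false = occ-label-fresh split′ T∈ T< (subst (_≤ c) (sym (trans (occ′ e) (+-identityʳ _))) occ≤c)
      by-occurrences (suc zero) e _ with occ (suc x₀) seen ≟ c
      ... | yes occ≡c rewrite dec-true (occ (suc x₀) seen ≟ c) occ≡c =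
        trans (cong (_+ rest) e) (cong suc (occ-label-used split′ T∈
          (subst (c <_) (sym (trans (occ′ e) (+-comm _ 1))) (s≤s (≤-reflexive (sym occ≡c))))))
      ... | no occ≢c rewrite dec-false (occ (suc x₀) seen ≟ c) occ≢c =
        occ-label-fresh split′ T∈ T< (subst (_≤ c) (sym (trans (occ′ e) (+-comm _ 1))) (≤∧≢⇒< occ≤c occ≢c))
      by-occurrences (suc (suc _)) _ (s≤s ())

  rowOf-labels-< : ∀ {x₀ c seen T} → x₀ < length γ → suc c < part γ x₀ → ContentSplit seen T →
    All (All (_∈[1, length γ ])) T → All (Linked _<_) T → occ (suc x₀) seen ≤ c →
    rowOf (offset γ x₀ + suc c) (standardizeFrom seen T) < rowOf (offset γ x₀ + suc (suc c)) (standardizeFrom seen T)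
  rowOf-labels-< {x₀} {c} {seen} {[]} x₀< c+1< split _ _ occ≤c =
    ⊥-elim (<⇒≱ c+1< (subst (_≤ suc c) (trans (sym (+-identityʳ _)) (occ-split split x₀ x₀<)) (m≤n⇒m≤1+n occ≤c)))
  rowOf-labels-< {x₀} {c} {seen} {r ∷ T} x₀< c+1< split (r∈ ∷ T∈) (r< ∷ T<) occ≤c =
    by-row (suc x₀ ∈ᵇ r) refl (occ (suc x₀) seen ≟ c)
    where
    rows = standardizeFrom (seen ++ r) T
    c< = <-trans (n<1+n c) c+1<
    position : ∀ c′ → c′ < part γ x₀ → ∀ {b} → suc x₀ ∈ᵇ r ∧ does (occ (suc x₀) seen ≟ c′) ≡ b →
      rowOf (offset γ x₀ + suc c′) (map (label seen) r ∷ rows) ≡ (if b then 0 else suc (rowOf (offset γ x₀ + suc c′) rows))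
    position c′ c′< e = cong (λ b → if b then 0 else suc (rowOf (offset γ x₀ + suc c′) rows))
      (trans (∈ᵇ-labels x₀< c′< seen r (row-pending split r∈)) e)
    below : ∀ {k} → occ (suc x₀) (seen ++ r) ≡ k → k ≤ c →
      rowOf (offset γ x₀ + suc c) rows < rowOf (offset γ x₀ + suc (suc c)) rows
    below occ≡k k≤c = rowOf-labels-< x₀< c+1< (ContentSplit-step split) T∈ T< (subst (_≤ c) (sym occ≡k) k≤c)
    by-row : ∀ b → suc x₀ ∈ᵇ r ≡ b → Dec (occ (suc x₀) seen ≡ c) →
      rowOf (offset γ x₀ + suc c) (map (label seen) r ∷ rows) < rowOf (offset γ x₀ + suc (suc c)) (map (label seen) r ∷ rows)
    by-row false x∉r _ =
      subst₂ _<_ (sym (position c c< (cong (_∧ _) x∉r))) (sym (position (suc c) c+1< (cong (_∧ _) x∉r)))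
        (s≤s (below (trans (occ-++ (suc x₀) seen r) (trans (cong (_ +_) (∉ᵇ⇒occ≡0 (suc x₀) r x∉r)) (+-identityʳ _))) occ≤c))
    by-row true x∈r (yes occ≡c) =
      subst₂ _<_ (sym (position c c< (trans (cong (_∧ _) x∈r) (dec-true (occ (suc x₀) seen ≟ c) occ≡c))))
        (sym (position (suc c) c+1< (trans (cong (_∧ _) x∈r)
          (dec-false (occ (suc x₀) seen ≟ suc c) (λ e → <-irrefl (trans (sym occ≡c) e) (n<1+n c))))))
        (s≤s z≤n)
    by-row true x∈r (no occ≢c) =
      subst₂ _<_ (sym (position c c< (trans (cong (_∧ _) x∈r) (dec-false (occ (suc x₀) seen ≟ c) occ≢c))))
        (sym (position (suc c) c+1< (trans (cong (_∧ _) x∈r) (dec-false (occ (suc x₀) seen ≟ suc c) (λ e → <-irrefl e (s≤s occ≤c))))))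
        (s≤s (below (trans (occ-++ (suc x₀) seen r) (trans (cong (_ +_) occ-r≡1) (+-comm _ 1))) (≤∧≢⇒< occ≤c occ≢c)))
      where
      occ-r≡1 : occ (suc x₀) r ≡ 1
      occ-r≡1 = ≤-antisym (occ-strict≤1 (suc x₀) r r<) (∈ᵇ⇒1≤occ (suc x₀) r x∈r)

  BlockAscents : List (List ℕ) → Set
  BlockAscents T = ∀ i → 1 ≤ i → i < sum γ → block γ i ≡ block γ (suc i) → rowOf i T < rowOf (suc i) T

  standardize-BlockAscents : ∀ {T} → ContentSplit [] T → All (All (_∈[1, length γ ])) T → All (Linked _<_) T →
    BlockAscents (standardize T)
  standardize-BlockAscents {T} split T∈ T< i 1≤i i<n same-block
    with offset-decomposition γ i 1≤i (<⇒≤ i<n) | offset-decomposition γ (suc i) (s≤s z≤n) i<n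
  ... | x₀ , c , x₀< , c< , refl | y₀ , c′ , y₀< , c′< , i+1≡
    with trans (sym (block-offset γ x₀ c x₀< c<)) (trans same-block (trans (cong (block γ) i+1≡) (block-offset γ y₀ c′ y₀< c′<)))
  ... | refl with +-cancelˡ-≡ (offset γ x₀) (suc (suc c)) (suc c′) (trans (+-suc (offset γ x₀) (suc c)) i+1≡)
  ... | refl = subst (λ j → rowOf (offset γ x₀ + suc c) (standardize T) < rowOf j (standardize T)) (+-suc (offset γ x₀) (suc c))
                 (rowOf-labels-< x₀< c′< split T∈ T< z≤n)

module Destandardization (γ : List ℕ) (T : List (List ℕ)) (T∈ : All (All (_∈[1, sum γ ])) T)
    (once : ∀ j → 1 ≤ j → j ≤ sum γ → occ j (concat T) ≡ 1) (ascents : Standardization.BlockAscents γ T) where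
  open Standardization γ

  same-block-ascent : ∀ j j′ → 1 ≤ j → j < j′ → j′ ≤ sum γ → block γ j ≡ block γ j′ → rowOf j T < rowOf j′ T
  same-block-ascent j (suc k) 1≤j j<k+1 k+1≤n same with m≤n⇒m<n∨m≡n (≤-pred j<k+1)
  ... | inj₂ refl = ascents j 1≤j k+1≤n same
  ... | inj₁ j<k = <-trans (same-block-ascent j k 1≤j j<k (<⇒≤ k+1≤n) bj≡bk) (ascents k (≤-trans 1≤j (<⇒≤ j<k)) k+1≤n bk≡bk+1)
    where
    bj≤bk = block-mono γ (<⇒≤ j<k)
    bk≤bk+1 = block-mono γ (n≤1+n k)
    bj≡bk : block γ j ≡ block γ k
    bj≡bk = ≤-antisym bj≤bk (subst (block γ k ≤_) (sym same) bk≤bk+1)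
    bk≡bk+1 : block γ k ≡ block γ (suc k)
    bk≡bk+1 = ≤-antisym bk≤bk+1 (subst (_≤ block γ k) same bj≤bk)

  module Row {pre : List (List ℕ)} {r : List ℕ} {post : List (List ℕ)} (T≡ : T ≡ pre ++ r ∷ post) where

    occ-concat : ∀ j → occ j (concat T) ≡ occ j (concat pre) + (occ j r + occ j (concat post))
    occ-concat j = begin
      occ j (concat T)                                        ≡⟨ cong (occ j ∘ concat) T≡ ⟩
      occ j (concat (pre ++ r ∷ post))                        ≡⟨ cong (occ j) (concat-++ pre (r ∷ post)) ⟨
      occ j (concat pre ++ r ++ concat post)                  ≡⟨ occ-++ j (concat pre) _ ⟩
      occ j (concat pre) + occ j (r ++ concat post)           ≡⟨ cong (occ j (concat pre) +_) (occ-++ j r (concat post)) ⟩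
      occ j (concat pre) + (occ j r + occ j (concat post))    ∎
      where open ≡-Reasoning

    absent-below : ∀ j → j ∈[1, sum γ ] → j ∈ᵇ r ≡ true → occ j (concat pre) ≡ 0
    absent-below j (1≤j , j≤n) j∈r =
      m+n≡1⇒m≡0 (occ j (concat pre)) _ (trans (sym (occ-concat j)) (once j 1≤j j≤n))
        (≤-trans (∈ᵇ⇒1≤occ j r j∈r) (m≤m+n _ _))

    rowOf-entry : ∀ j → j ∈[1, sum γ ] → j ∈ᵇ r ≡ true → rowOf j T ≡ length pre
    rowOf-entry j j∈ j∈r = begin
      rowOf j T                         ≡⟨ cong (rowOf j) T≡ ⟩
      rowOf j (pre ++ r ∷ post)         ≡⟨ rowOf-++-∉ j pre (r ∷ post) (occ≡0⇒∉ᵇ j (concat pre) (absent-below j j∈ j∈r)) ⟩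
      length pre + rowOf j (r ∷ post)   ≡⟨ cong (length pre +_) (rowOf-∷-∈ {j} {r} {post} j∈r) ⟩
      length pre + 0                    ≡⟨ +-identityʳ _ ⟩
      length pre                        ∎
      where open ≡-Reasoning

    InRow : ℕ → Set
    InRow j = j ∈[1, sum γ ] × j ∈ᵇ r ≡ true × rowOf j T ≡ length pre

    row-entries : All InRow r
    row-entries = All.map (λ { {j} (j∈ , 1≤occ) → j∈ , 1≤occ⇒∈ᵇ j r 1≤occ , rowOf-entry j j∈ (1≤occ⇒∈ᵇ j r 1≤occ) })
      (All.zip (All.head (++⁻ʳ pre (subst (All (All (_∈[1, sum γ ]))) T≡ T∈)) , occ-self r))

    letter-< : ∀ {a b} → InRow a → InRow b → a < b → letter a < letter b
    letter-< ((1≤a , _) , _ , row-a) ((_ , b≤n) , _ , row-b) a<b = s≤s (≤∧≢⇒< (block-mono γ (<⇒≤ a<b))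
      (λ same → <-irrefl (trans row-a (sym row-b)) (same-block-ascent _ _ 1≤a a<b b≤n same)))

    module _ {x₀ c : ℕ} (x₀< : x₀ < length γ) (c< : c < part γ x₀) (j-in-row : InRow (offset γ x₀ + suc c)) where

      private
        o = offset γ x₀
        j = o + suc c

      window : ℕ → Bool
      window v = does (o <? v) ∧ does (v ≤? o + c)

      window-beyond : ∀ v → j ≤ v → window v ≡ false
      window-beyond v j≤v = trans (cong (does (o <? v) ∧_) (dec-false (v ≤? o + c) (<⇒≱ (subst (_≤ v) (+-suc o c) j≤v)))) (∧-zeroʳ _)

      occ-earlier : ∀ v → 1 ≤ v → v < j → block γ v ≡ block γ j → occ v (concat pre) ≡ 1
      occ-earlier v 1≤v v<j same = ≤-antisym
        (≤-trans (m≤m+n _ _) (≤-reflexive (trans (sym (occ-concat v)) (once v 1≤v v≤n))))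
        (∈ᵇ⇒1≤occ v (concat pre) (rowOf-++-<⇒∈ v pre (r ∷ post)
          (subst (λ U → rowOf v U < length pre) T≡ (<-≤-trans (same-block-ascent v j 1≤v v<j j≤n same) (≤-reflexive row-j)))))
        where
        j≤n = proj₂ (proj₁ j-in-row)
        row-j = proj₂ (proj₂ j-in-row)
        v≤n = ≤-trans (<⇒≤ v<j) j≤n

      occ-later : ∀ v → j < v → v ≤ sum γ → block γ j ≡ block γ v → occ v (concat pre) ≡ 0
      occ-later v j<v v≤n same = ∉ᵇ⇒occ≡0 v (concat pre) v∉
        where
        v∉ : v ∈ᵇ concat pre ≡ false
        v∉ with v ∈ᵇ concat pre in v∈
        ... | false = refl
        ... | true = ⊥-elim (<-asym (subst (λ U → rowOf v U < length pre) (sym T≡) (rowOf-++-∈ v pre (r ∷ post) v∈))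
          (subst (_< rowOf v T) (proj₂ (proj₂ j-in-row)) (same-block-ascent j v (≤-trans (s≤s z≤n) (m≤n+m (suc c) o)) j<v v≤n same)))

      occ-pre : ∀ v → 1 ≤ v → v ≤ sum γ → (if does (x₀ ≟ block γ v) then occ v (concat pre) else 0) ≡ χ (window v)
      occ-pre v 1≤v v≤n with x₀ ≟ block γ v
      ... | no x₀≢ rewrite dec-false (x₀ ≟ block γ v) x₀≢ = cong χ (sym (¬-not outside))
        where
        outside : window v ≢ true
        outside in-window = x₀≢ (does-true⇒ (x₀ ≟ block γ v) (trans (does-≟-block γ x₀ v x₀< 1≤v v≤n)
          (cong₂ _∧_ (∧-conicalˡ _ _ in-window)
            (dec-true (v ≤? o + part γ x₀) (≤-trans (does-true⇒ (v ≤? o + c) (∧-conicalʳ _ _ in-window)) (+-monoʳ-≤ o (<⇒≤ c<)))))))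
      ... | yes x₀≡ rewrite dec-true (x₀ ≟ block γ v) x₀≡ with <-cmp v j
      ...   | tri< v<j _ _ = trans (occ-earlier v 1≤v v<j same) (cong χ (sym in-window))
        where
        same = trans (sym x₀≡) (sym (block-offset γ x₀ c x₀< c<))
        o<v : o < v
        o<v = does-true⇒ (o <? v) (∧-conicalˡ _ _ (trans (sym (does-≟-block γ x₀ v x₀< 1≤v v≤n)) (dec-true (x₀ ≟ block γ v) x₀≡)))
        in-window : window v ≡ true
        in-window = trans (cong (_∧ does (v ≤? o + c)) (dec-true (o <? v) o<v))
          (dec-true (v ≤? o + c) (≤-pred (subst (v <_) (+-suc o c) v<j)))
      ...   | tri≈ _ refl _ = trans (absent-below j (proj₁ j-in-row) (proj₁ (proj₂ j-in-row))) (cong χ (sym (window-beyond j ≤-refl)))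
      ...   | tri> _ _ j<v =
        trans (occ-later v j<v v≤n (trans (block-offset γ x₀ c x₀< c<) x₀≡)) (cong χ (sym (window-beyond v (<⇒≤ j<v))))

      label-letter : label (map letter (concat pre)) (letter j) ≡ j
      label-letter = begin
        label (map letter (concat pre)) (letter j)
          ≡⟨ cong (label (map letter (concat pre))) (cong suc (block-offset γ x₀ c x₀< c<)) ⟩
        o + suc (occ (suc x₀) (map letter (concat pre)))
          ≡⟨ cong (λ k → o + suc k)
               (trans (occ≡count (suc x₀) (map letter (concat pre))) (count-map (λ y → does (suc x₀ ≟ y)) letter (concat pre))) ⟩
        o + suc (count (λ v → does (x₀ ≟ block γ v)) (concat pre))
          ≡⟨ cong (λ k → o + suc k) (count-by-occ _ window (sum γ) (concat pre) pre∈ occ-pre) ⟩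
        o + suc (count window (interval 1 (sum γ)))
          ≡⟨ cong (λ k → o + suc k)
               (count-window window (sum γ) o c (≤-trans (+-monoʳ-≤ o (<⇒≤ c<)) (offset+part≤sum γ x₀ x₀<)) (λ _ _ _ → refl)) ⟩
        j ∎
        where
        open ≡-Reasoning
        pre∈ : All (_∈[1, sum γ ]) (concat pre)
        pre∈ = concat⁺ (++⁻ˡ pre (subst (All (All (_∈[1, sum γ ]))) T≡ T∈))

    label-letter-entry : ∀ {j} → InRow j → label (map letter (concat pre)) (letter j) ≡ j
    label-letter-entry {j} j-in-row with offset-decomposition γ j (proj₁ (proj₁ j-in-row)) (proj₂ (proj₁ j-in-row))
    ... | x₀ , c , x₀< , c< , refl = label-letter x₀< c< j-in-row

  private
    shift : ∀ {pre r post} → T ≡ pre ++ r ∷ post → T ≡ (pre ++ [ r ]) ++ post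
    shift {pre} {r} {post} T≡ = trans T≡ (sym (++-assoc pre [ r ] post))

  destandardize-rows : ∀ pre {post} → T ≡ pre ++ post → All (Linked _<_) post → All (Linked _<_) (destandardize post)
  destandardize-rows pre {[]} _ [] = []
  destandardize-rows pre {r ∷ post} T≡ (r< ∷ post<) =
    Linked-map-local letter r< (Row.row-entries T≡) (Row.letter-< T≡) ∷ destandardize-rows (pre ++ [ r ]) (shift T≡) post<

  standardizeFrom-destandardize : ∀ pre {post} → T ≡ pre ++ post →
    standardizeFrom (map letter (concat pre)) (destandardize post) ≡ post
  standardizeFrom-destandardize pre {[]} _ = refl
  standardizeFrom-destandardize pre {r ∷ post} T≡ =
    cong₂ _∷_ (trans (sym (map-∘ r)) (map-id-local (All.map (Row.label-letter-entry T≡) (Row.row-entries T≡))))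
      (trans (cong (λ seen → standardizeFrom seen (destandardize post)) seen≡)
        (standardizeFrom-destandardize (pre ++ [ r ]) (shift T≡)))
    where
    seen≡ : map letter (concat pre) ++ map letter r ≡ map letter (concat (pre ++ [ r ]))
    seen≡ = trans (sym (map-++ letter (concat pre) r))
      (cong (map letter) (trans (cong (concat pre ++_) (sym (++-identityʳ r))) (concat-++ pre [ r ])))

  destandardize-content : ∀ x₀ → x₀ < length γ → occ (suc x₀) (concat (destandardize T)) ≡ part γ x₀
  destandardize-content x₀ x₀< = begin
    occ (suc x₀) (concat (map (map letter) T))
      ≡⟨ cong (occ (suc x₀)) (concat-map T) ⟩
    occ (suc x₀) (map letter (concat T))
      ≡⟨ trans (occ≡count (suc x₀) (map letter (concat T))) (count-map (λ y → does (suc x₀ ≟ y)) letter (concat T)) ⟩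
    count (λ v → does (x₀ ≟ block γ v)) (concat T)
      ≡⟨ count-by-occ _ _ (sum γ) (concat T) (concat⁺ T∈) once-in-block ⟩
    count (λ v → does (x₀ ≟ block γ v)) (interval 1 (sum γ))
      ≡⟨ count-block γ x₀ x₀< ⟩
    part γ x₀ ∎
    where
    open ≡-Reasoning
    once-in-block : ∀ v → 1 ≤ v → v ≤ sum γ →
      (if does (x₀ ≟ block γ v) then occ v (concat T) else 0) ≡ χ (does (x₀ ≟ block γ v))
    once-in-block v 1≤v v≤n rewrite once v 1≤v v≤n with does (x₀ ≟ block γ v)
    ... | true = refl
    ... | false = refl

map-interval⁻ : ∀ (f : ℕ → ℕ) k L → map f (interval k (length L)) ≡ L → ∀ i → i < length L → f (k + i) ≡ part L i
map-interval⁻ f k (y ∷ L) e zero _ = trans (cong f (+-identityʳ k)) (proj₁ (∷-injective e))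
map-interval⁻ f k (y ∷ L) e (suc i) (s≤s i<) = trans (cong f (+-suc k i)) (map-interval⁻ f (suc k) L (proj₂ (∷-injective e)) i i<)

map-interval⁺ : ∀ (f : ℕ → ℕ) k L → (∀ i → i < length L → f (k + i) ≡ part L i) → map f (interval k (length L)) ≡ L
map-interval⁺ f k [] _ = refl
map-interval⁺ f k (y ∷ L) h = cong₂ _∷_ (trans (cong f (sym (+-identityʳ k))) (h 0 (s≤s z≤n)))
  (map-interval⁺ f (suc k) L (λ i i< → trans (cong f (sym (+-suc k i))) (h (suc i) (s≤s i<))))

contentUpTo-length : ∀ (L : List ℕ) T → contentUpTo (length L) T ≡ map (λ i → occ (suc i) (concat T)) (interval 0 (length L))
contentUpTo-length L T = cong (map (λ i → occ (suc i) (concat T))) (upTo≡interval (length L))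

HasContent⇔ : ∀ γ T → HasContent γ T ⇔ (∀ x → x < length γ → occ (suc x) (concat T) ≡ part γ x)
HasContent⇔ γ T = mk⇔
  (λ content → map-interval⁻ occ-next 0 γ (trans (sym (contentUpTo-length γ T)) content))
  (λ occ≡ → trans (contentUpTo-length γ T) (map-interval⁺ occ-next 0 γ occ≡))
  where
  occ-next : ℕ → ℕ
  occ-next i = occ (suc i) (concat T)

part-replicate : ∀ n i → i < n → part (replicate n 1) i ≡ 1
part-replicate (suc n) zero _ = refl
part-replicate (suc n) (suc i) (s≤s i<) = part-replicate n i i<

standard-content⇔ : ∀ n T → (contentUpTo n T ≡ replicate n 1) ⇔ (∀ j → 1 ≤ j → j ≤ n → occ j (concat T) ≡ 1)
standard-content⇔ n T = mk⇔ to from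
  where
  ones = replicate n 1
  n≡ : length ones ≡ n
  n≡ = length-replicate n
  to : contentUpTo n T ≡ ones → ∀ j → 1 ≤ j → j ≤ n → occ j (concat T) ≡ 1
  to content (suc i) _ j≤n = trans (Equivalence.to (HasContent⇔ ones T) (subst (λ k → contentUpTo k T ≡ ones) (sym n≡) content)
    i (subst (i <_) (sym n≡) j≤n)) (part-replicate n i j≤n)
  from : (∀ j → 1 ≤ j → j ≤ n → occ j (concat T) ≡ 1) → contentUpTo n T ≡ ones
  from once = subst (λ k → contentUpTo k T ≡ ones) n≡ (Equivalence.from (HasContent⇔ ones T)
    (λ i i< → trans (once (suc i) (s≤s z≤n) (subst (i <_) n≡ i<)) (sym (part-replicate n i (subst (i <_) n≡ i<)))))

DesRS⊆setOf⇔BlockAscents : ∀ γ T → DesRS⊆setOf (sum γ) γ T ⇔ Standardization.BlockAscents γ T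
DesRS⊆setOf⇔BlockAscents γ T = mk⇔
  (λ ⊆ i 1≤i i<n same → ⊆ i 1≤i i<n
    (trans (∈ᵇ-setOf≡block-change γ i 1≤i i<n) (cong not (dec-true (block γ i ≟ block γ (suc i)) same))))
  (λ ascents i 1≤i i<n i∉ → ascents i 1≤i i<n (does-true⇒ (block γ i ≟ block γ (suc i))
    (trans (sym (not-involutive _)) (cong not (trans (sym (∈ᵇ-setOf≡block-change γ i 1≤i i<n)) i∉)))))

DesRS-≽⇔BlockAscents : ∀ γ T → 1 ≤ sum γ → IsComposition (sum γ) γ →
  (comp (sum γ) (DesRS (sum γ) T) ≽ γ) ⇔ Standardization.BlockAscents γ T
DesRS-≽⇔BlockAscents γ T 1≤n cγ = ⇔-trans (DesRS-≽⇔DesRS⊆setOf (sum γ) γ T 1≤n cγ) (DesRS⊆setOf⇔BlockAscents γ T)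

module Bijection (γ : List ℕ) where
  open Standardization γ

  standardize-correct : ∀ {α T} → All (0 <_) α → IsFilling α (length γ) T → RowStrictImmaculate T → HasContent γ T →
    IsFilling α (sum γ) (standardize T) × Standard (sum γ) (standardize T) × BlockAscents (standardize T) ×
    destandardize (standardize T) ≡ T
  standardize-correct {α} {T} pos fill (column , rows) content =
    standardizeFrom-IsFilling fill split ,
    (Equivalence.from (standard-content⇔ (sum γ) (standardize T)) once ,
      standardizeFrom-firstColumn (IsFilling⇒rows-nonempty pos fill) split T∈ column ,
      standardizeFrom-rows split T∈ rows) ,
    standardize-BlockAscents split T∈ rows ,
    destandardize-standardizeFrom split T∈
    where
    split : ContentSplit [] T
    split = content-split (Equivalence.to (HasContent⇔ γ T) content)
    T∈ = IsFilling⇒entries fill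
    once : ∀ j → 1 ≤ j → j ≤ sum γ → occ j (concat (standardize T)) ≡ 1
    once j 1≤j j≤n with offset-decomposition γ j 1≤j j≤n
    ... | x₀ , c , x₀< , c< , refl = occ-label-fresh x₀< c< split T∈ rows z≤n

  letter-∈[1,length] : ∀ {j} → j ∈[1, sum γ ] → letter j ∈[1, length γ ]
  letter-∈[1,length] {j} (1≤j , j≤n) with offset-decomposition γ j 1≤j j≤n
  ... | x₀ , c , x₀< , c< , refl = s≤s z≤n , subst (_≤ length γ) (sym (cong suc (block-offset γ x₀ c x₀< c<))) x₀<

  destandardize-IsFilling : ∀ {α T} → IsFilling α (sum γ) T → IsFilling α (length γ) (destandardize T)
  destandardize-IsFilling [] = []
  destandardize-IsFilling (_∷_ {y = r} (len , r∈) fill) =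
    (trans (length-map letter r) len , map⁺ (All.map letter-∈[1,length] r∈)) ∷ destandardize-IsFilling fill

  destandardize-correct : ∀ {α T} → IsFilling α (sum γ) T → Standard (sum γ) T → BlockAscents T →
    IsFilling α (length γ) (destandardize T) × RowStrictImmaculate (destandardize T) × HasContent γ (destandardize T) ×
    standardize (destandardize T) ≡ T
  destandardize-correct {α} {T} fill (content , column , rows) ascents =
    destandardize-IsFilling fill ,
    (subst (Linked _≤_) (sym (firstColumn-map letter T)) (Linked-map⁺ (Linked.map (λ a<b → s≤s (block-mono γ (<⇒≤ a<b))) column)) ,
      D.destandardize-rows [] refl rows) ,
    Equivalence.from (HasContent⇔ γ (destandardize T)) D.destandardize-content ,
    D.standardizeFrom-destandardize [] refl
    where
    module D = Destandardization γ T (IsFilling⇒entries fill) (Equivalence.to (standard-content⇔ (sum γ) T) content) ascents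

  Kstar≡count-standard : ∀ α → IsComposition (sum γ) α → 1 ≤ sum γ → IsComposition (sum γ) γ →
    Kstar α γ ≡ length (filter (λ T → standard? (sum γ) T ×-dec (comp (sum γ) (DesRS (sum γ) T) ≽? γ)) (fillings α (sum γ)))
  Kstar≡count-standard α (pos , _) 1≤n cγ =
    trans (cong length (filter≡filterᵇ immaculate? (fillings α (length γ))))
      (trans (count-bijection _≟ₜ_ _≟ₜ_ (does ∘ immaculate?) (does ∘ standard-≽?) standardize destandardize
                (fillings-valid α (length γ)) (fillings-valid α (sum γ)) forward backward)
        (sym (cong length (filter≡filterᵇ standard-≽? (fillings α (sum γ))))))
    where
    immaculate? = λ T → rowStrictImmaculate? T ×-dec hasContent? γ T
    standard-≽? = λ T → standard? (sum γ) T ×-dec (comp (sum γ) (DesRS (sum γ) T) ≽? γ)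
    forward : ∀ {T} → IsFilling α (length γ) T → does (immaculate? T) ≡ true →
      does (standard-≽? (standardize T)) ≡ true × destandardize (standardize T) ≡ T ×
      multiplicity _≟ₜ_ (standardize T) (fillings α (sum γ)) ≡ 1
    forward {T} fill immaculate with does-true⇒ (immaculate? T) immaculate
    ... | rsi , content with standardize-correct pos fill rsi content
    ...   | fill′ , std , ascents , inverse =
      dec-true (standard-≽? (standardize T)) (std , Equivalence.from (DesRS-≽⇔BlockAscents γ (standardize T) 1≤n cγ) ascents) ,
      inverse , multiplicity-fillings α (sum γ) _ fill′
    backward : ∀ {T} → IsFilling α (sum γ) T → does (standard-≽? T) ≡ true →
      does (immaculate? (destandardize T)) ≡ true × standardize (destandardize T) ≡ T ×
      multiplicity _≟ₜ_ (destandardize T) (fillings α (length γ)) ≡ 1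
    backward {T} fill standard with does-true⇒ (standard-≽? T) standard
    ... | std , DesRS≽γ with destandardize-correct fill std (Equivalence.to (DesRS-≽⇔BlockAscents γ T 1≤n cγ) DesRS≽γ)
    ...   | fill′ , rsi , content , inverse =
      dec-true (immaculate? (destandardize T)) (rsi , content) , inverse , multiplicity-fillings α (length γ) _ fill′

coarsenings-compositions : ∀ n γ → All (IsComposition n) (coarsenings n γ)
coarsenings-compositions n γ = filter⁺ (_≽? γ) (all-filter (isComposition? n) (concatMap (λ k → listsOf k n) (upTo (suc n))))

theorem3p9 : (n : ℕ) (α γ : List ℕ) → 1 ≤ n →
    IsComposition n α → IsComposition n γ → γ ≤ℓ α →
    (Kstar α γ ≡ sum (map (λ β → L α (complement n β)) (coarsenings n γ)))
    × (Kstar α γ ≡ sum (map (λ β → Lstar α β) (coarsenings n γ)))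
theorem3p9 .(sum γ) α γ 1≤n cα cγ@(_ , refl) _ = Kstar≡sum-L-complement , Kstar≡sum-Lstar
  where
  n = sum γ
  Kstar≡sum-Lstar : Kstar α γ ≡ sum (map (Lstar α) (coarsenings n γ))
  Kstar≡sum-Lstar = trans (Bijection.Kstar≡count-standard γ α cα 1≤n cγ) (sym (sum-Lstar-coarsenings n α γ (proj₂ cα) 1≤n))
  Kstar≡sum-L-complement : Kstar α γ ≡ sum (map (λ β → L α (complement n β)) (coarsenings n γ))
  Kstar≡sum-L-complement = trans Kstar≡sum-Lstar
    (sum-map-cong-local (All.map (λ cβ → sym (L-complement≡Lstar n α _ 1≤n cα cβ)) (coarsenings-compositions n γ)))
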